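{- Let $n$ be a non-negative integer and $k,m$ positive integers, and let $r_0<r_1<\dots<r_{k-1}$ and $s_0<s_1<\dots<s_{k-1}$ be integers with $1\le r_i,s_i\le k+m$ for all $i$. Let $\bar r_0<\dots<\bar r_{m-1}$ be the elements of $\{1,\dots,k+m\}\setminus\{r_0,\dots,r_{k-1}\}$ and $\bar s_0<\dots<\bar s_{m-1}$ the elements of $\{1,\dots,k+m\}\setminus\{s_0,\dots,s_{k-1}\}$. Then $$\det\left(C_{2n}^{(2k+2m-1)}(2r_i-2\to 2s_j-2)\right)_{0\le i,j\le k-1}=(-1)^{\sum_{i=0}^{m-1}(\bar r_i+\bar s_i)}\det\left(C_{ -2n}^{(2k+2m-1)}(2\bar r_i-2\to 2\bar s_j-2)\right)_{0\le i,j\le m-1}.$$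
   Context: An up-down path is a lattice path with steps $(1,1)$ and $(1,-1)$. For an integer $K\ge0$, integers $0\le r,s\le K$ and $N\ge0$, $C_N^{(K)}(r\to s)$ denotes the number of up-down paths from $(0,r)$ to $(N,s)$ that never pass below the $x$-axis and never pass above the line $y=K$. For $K$ odd and fixed $r,s$, the generating function $f(x)=\sum_{N\ge0}C_N^{(K)}(r\to s)x^N$ is a rational function $p(x)/q(x)$ with $q(0)\ne0$ and $\deg p<\deg q$; the values at negative lengths are defined by $\sum_{N\ge1}C_{ -N}^{(K)}(r\to s)x^N=-f(1/x)$ (equivalently, the sequence is extended to all $N\in\mathbb Z$ so that the linear recurrence with constant coefficients given by $q$ holds for all $N$). -}

module Defs where

open import Data.Bool using (Bool; true; false; _∧_; if_then_else_)
open import Data.Nat as ℕ using (ℕ; zero; suc; _≡ᵇ_; _≤ᵇ_)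
open import Data.Integer as ℤ using (ℤ; +_; _-_; _*_; _+_)
open import Data.List using (List; []; _∷_; _++_; map; filter; length)
open import Data.Vec using (Vec; []; _∷_)
open import Data.Fin using (Fin; zero; suc; punchIn; toℕ)
open import Data.Product using (Σ; _×_; ∃)
open import Relation.Binary.PropositionalEquality using (_≡_; _≢_)
open import Relation.Nullary using (¬_)
open import Relation.Nullary.Decidable using (T?)

-- Up-down paths.  A path of length N is a vector of steps
-- (true = up step (1,1), false = down step (1,-1)).

allSteps : (N : ℕ) → List (Vec Bool N)
allSteps zero    = [] ∷ []
allSteps (suc N) = map (true ∷_) (allSteps N) ++ map (false ∷_) (allSteps N)

validPath : (K h s : ℕ) → {N : ℕ} → Vec Bool N → Bool
validPath K h s []           = h ≡ᵇ s
validPath K h s (true ∷ bs)  = (suc h ≤ᵇ K) ∧ validPath K (suc h) s bs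
validPath K zero s (false ∷ bs)    = false
validPath K (suc h) s (false ∷ bs) = validPath K h s bs

C : (K N r s : ℕ) → ℕ
C K N r s = length (filter (λ p → T? (validPath K r s p)) (allSteps N))

recSum : List ℤ → (ℤ → ℤ) → ℤ → ℤ
recSum []       E N = + 0
recSum (c ∷ cs) E N = c * E N + recSum cs E (N - + 1)

-- E : ℤ → ℤ is the extension of N ↦ C_N^{(K)}(r → s) to all N ∈ ℤ:
-- it agrees with C on N ≥ 0, and there is a polynomial q with q(0) ≠ 0
-- (the denominator of the generating function, f = p/q, deg p < deg q)
-- such that the constant-coefficient linear recurrence given by q holds
-- for all N ∈ ℤ.
IsExtension : (K r s : ℕ) → (ℤ → ℤ) → Set
IsExtension K r s E =
  ((N : ℕ) → E (+ N) ≡ + C K N r s) ×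
  Σ ℤ λ q₀ → Σ (List ℤ) λ qs →
    (q₀ ≢ + 0) × ((N : ℤ) → recSum (q₀ ∷ qs) E N ≡ + 0)

sumFin : {n : ℕ} → (Fin n → ℤ) → ℤ
sumFin {zero}  f = + 0
sumFin {suc n} f = f zero + sumFin (λ i → f (suc i))

det : {n : ℕ} → (Fin n → Fin n → ℤ) → ℤ
det {zero}  M = + 1
det {suc n} M =
  sumFin (λ j → (ℤ.- + 1) ℤ.^ toℕ j * M zero j
                  * det (λ a b → M (suc a) (punchIn j b)))

StrictlyIncreasing : {n : ℕ} → (Fin n → ℕ) → Set
StrictlyIncreasing {n} f = (i j : Fin n) → toℕ i ℕ.< toℕ j → f i ℕ.< f j

IsComplementEnum : {k m : ℕ} → (N : ℕ) → (Fin k → ℕ) → (Fin m → ℕ) → Set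
IsComplementEnum {k} {m} N r rbar =
  StrictlyIncreasing rbar ×
  ((i : Fin m) → (1 ℕ.≤ rbar i) × (rbar i ℕ.≤ N) × ((j : Fin k) → rbar i ≢ r j)) ×
  ((x : ℕ) → 1 ℕ.≤ x → x ℕ.≤ N → ((j : Fin k) → x ≢ r j) → ∃ λ i → rbar i ≡ x)

{-# OPTIONS --safe #-}
module Submission where

-- Let L = k + m and K = 2L − 1, and let X_N be the L × L matrix of path counts C_N^{(K)} between
-- the even heights 0, 2, …, 2L − 2, extended to N ∈ ℤ. The one-step recurrence
-- C_{N+1}(x,y) = C_N(x+1,y) + C_N(x−1,y) persists for negative N, since the difference of its two
-- sides satisfies a linear recurrence and vanishes for N ≥ 0. Two steps of it give X_{N+2} = D U X_N,
-- where U adds to each row the next one and D = Uᵀ adds to each row the previous one; so X_{2n} and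
-- X_{−2n} are built from the identity by elementary adjacent row operations. Jacobi's identity
-- relating the minors of a unimodular matrix to the complementary minors of its inverse transpose is
-- then proved one row operation at a time, and the inverse transpose of X_{2n} is X_{−2n} because
-- U⁻ᵀ = D⁻¹ and D⁻ᵀ = U⁻¹.

module Proof where

  open import Defs
  open import Data.Bool using (Bool; true; false; T; if_then_else_)
  open import Data.Nat as ℕ
    using (ℕ; zero; suc; _<_; _≤_; z≤n; s≤s; _∸_; _≤ᵇ_; _≡ᵇ_)
  import Data.Nat.Properties as ℕP
  open import Data.Integer as ℤ using (ℤ; +_; -_; -[1+_]; _+_; _*_; _-_; _^_; ∣_∣)
  import Data.Integer.Properties as ℤP
  open import Data.Integer.Tactic.RingSolver using (solve-∀)
  open import Algebra.Properties.AbelianGroup ℤP.+-0-abelianGroup using (∙-cancelˡ)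
  open import Data.Fin using (Fin; zero; suc; toℕ; fromℕ<; punchIn; punchOut; pinch)
  import Data.Fin.Properties as FinP
  open import Data.List using (List; []; _∷_; _++_; map; filter; length)
  open import Data.List.Properties using (filter-++; length-++)
  open import Data.List.Relation.Unary.All using (All; []; _∷_)
  open import Data.List.Relation.Unary.Any using (Any; here; there; any?)
  open import Data.Vec using (Vec; []; _∷_)
  open import Data.Product using (Σ; _×_; _,_; ∃; proj₁; proj₂)
  open import Data.Sum using (_⊎_; inj₁; inj₂)
  open import Data.Empty using (⊥-elim)
  open import Data.Unit using (tt)
  open import Function using (_∘_)
  open import Data.Vec.Functional using (updateAt)
  open import Data.Vec.Functional.Properties using (updateAt-updates; updateAt-minimal)
  open import Relation.Nullary using (¬_; Dec; yes; no; ¬?)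
  open import Relation.Nullary.Decidable using (T?; does; dec-true; dec-false)
  open import Relation.Binary.Definitions using (tri<; tri≈; tri>)
  open import Relation.Binary.PropositionalEquality
  import Algebra.Properties.Semiring.Sum as SemiringSum

  module ℤΣ = SemiringSum ℤP.+-*-semiring
  module ℕΣ = SemiringSum ℕP.+-*-semiring

  -1^-suc : ∀ n → (- + 1) ^ suc n ≡ - (- + 1) ^ n
  -1^-suc n = ℤP.-1*i≡-i ((- + 1) ^ n)

  -1^-double : ∀ n → (- + 1) ^ (n ℕ.+ n) ≡ + 1
  -1^-double zero    = refl
  -1^-double (suc n) = begin
    (- + 1) ^ suc (n ℕ.+ suc n)           ≡⟨ cong (λ e → (- + 1) ^ suc e) (ℕP.+-suc n n) ⟩
    - + 1 * (- + 1 * (- + 1) ^ (n ℕ.+ n)) ≡⟨ cong (λ x → - + 1 * (- + 1 * x)) (-1^-double n) ⟩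
    + 1                                   ∎
    where open ≡-Reasoning

  sumFin≡sum : ∀ {n} (f : Fin n → ℤ) → sumFin f ≡ ℤΣ.sum f
  sumFin≡sum {zero}  f = refl
  sumFin≡sum {suc n} f = cong (_+_ (f zero)) (sumFin≡sum (f ∘ suc))

  sumFin-cong : ∀ {n} {f g : Fin n → ℤ} → (∀ i → f i ≡ g i) → sumFin f ≡ sumFin g
  sumFin-cong {zero}  e = refl
  sumFin-cong {suc n} e = cong₂ _+_ (e zero) (sumFin-cong (e ∘ suc))

  sumFin-zero : ∀ {n} (f : Fin n → ℤ) → (∀ i → f i ≡ + 0) → sumFin f ≡ + 0
  sumFin-zero {n} f e =
    trans (sumFin-cong e) (trans (sumFin≡sum {n} (λ _ → + 0)) (ℤΣ.sum-replicate-zero n))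

  sumFin-distrib-+ : ∀ {n} (f g : Fin n → ℤ) →
    sumFin (λ i → f i + g i) ≡ sumFin f + sumFin g
  sumFin-distrib-+ f g
    rewrite sumFin≡sum f | sumFin≡sum g | sumFin≡sum (λ i → f i + g i) = ℤΣ.∑-distrib-+ f g

  sumFin-*ˡ : ∀ {n} (c : ℤ) (f : Fin n → ℤ) → sumFin (λ i → c * f i) ≡ c * sumFin f
  sumFin-*ˡ c f
    rewrite sumFin≡sum f | sumFin≡sum (λ i → c * f i) = sym (ℤΣ.*-distribˡ-sum c f)

  sumFin-neg : ∀ {n} (f : Fin n → ℤ) → sumFin (λ i → - f i) ≡ - sumFin f
  sumFin-neg f = trans (sumFin-cong (λ i → sym (ℤP.-1*i≡-i (f i))))
                       (trans (sumFin-*ˡ (- + 1) f) (ℤP.-1*i≡-i (sumFin f)))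

  sumFin-punchIn : ∀ {n} (f : Fin (suc n) → ℤ) (j : Fin (suc n)) →
    sumFin f ≡ f j + sumFin (f ∘ punchIn j)
  sumFin-punchIn f j
    rewrite sumFin≡sum f | sumFin≡sum (f ∘ punchIn j) = ℤΣ.sum-remove f

  sumFin-comm : ∀ {n m} (h : Fin n → Fin m → ℤ) →
    sumFin (λ i → sumFin (h i)) ≡ sumFin (λ j → sumFin (λ i → h i j))
  sumFin-comm h = begin
    sumFin (λ i → sumFin (h i))              ≡⟨ sumFin≡sum (λ i → sumFin (h i)) ⟩
    ℤΣ.sum (λ i → sumFin (h i))              ≡⟨ ℤΣ.sum-cong-≗ (λ i → sumFin≡sum (h i)) ⟩
    ℤΣ.sum (λ i → ℤΣ.sum (h i))              ≡⟨ ℤΣ.∑-comm h ⟩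
    ℤΣ.sum (λ j → ℤΣ.sum (λ i → h i j))      ≡⟨ ℤΣ.sum-cong-≗ (λ j → sumFin≡sum (λ i → h i j)) ⟨
    ℤΣ.sum (λ j → sumFin (λ i → h i j))      ≡⟨ sumFin≡sum (λ j → sumFin (λ i → h i j)) ⟨
    sumFin (λ j → sumFin (λ i → h i j))      ∎
    where open ≡-Reasoning

  i≡-i⇒i≡0 : ∀ i → i ≡ - i → i ≡ + 0
  i≡-i⇒i≡0 (+ zero)   _ = refl
  i≡-i⇒i≡0 (+ suc n)  ()
  i≡-i⇒i≡0 -[1+ n ]   ()

  sumFin-offDiagonal-transpose : ∀ {n} (h : Fin (suc n) → Fin (suc n) → ℤ) →
    sumFin (λ j → sumFin (λ j′ → h j (punchIn j j′))) ≡
    sumFin (λ j → sumFin (λ j′ → h (punchIn j j′) j))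
  sumFin-offDiagonal-transpose h = ∙-cancelˡ (sumFin (λ j → h j j)) _ _ (begin
    sumFin (λ j → h j j) + sumFin (λ j → sumFin (λ j′ → h j (punchIn j j′)))
      ≡⟨ sumFin-distrib-+ (λ j → h j j) (λ j → sumFin (λ j′ → h j (punchIn j j′))) ⟨
    sumFin (λ j → h j j + sumFin (λ j′ → h j (punchIn j j′)))
      ≡⟨ sumFin-cong (λ j → sumFin-punchIn (h j) j) ⟨
    sumFin (λ j → sumFin (h j))
      ≡⟨ sumFin-comm h ⟩
    sumFin (λ k → sumFin (λ j → h j k))
      ≡⟨ sumFin-cong (λ k → sumFin-punchIn (λ j → h j k) k) ⟩
    sumFin (λ j → h j j + sumFin (λ j′ → h (punchIn j j′) j))
      ≡⟨ sumFin-distrib-+ (λ j → h j j) (λ j → sumFin (λ j′ → h (punchIn j j′) j)) ⟩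
    sumFin (λ j → h j j) + sumFin (λ j → sumFin (λ j′ → h (punchIn j j′) j)) ∎)
    where open ≡-Reasoning

  sumFin-offDiagonal-antisym : ∀ {n} (h : Fin (suc n) → Fin (suc n) → ℤ) →
    (∀ j k → j ≢ k → h k j ≡ - h j k) →
    sumFin (λ j → sumFin (λ j′ → h j (punchIn j j′))) ≡ + 0
  sumFin-offDiagonal-antisym h anti = i≡-i⇒i≡0 _ (begin
    sumFin (λ j → sumFin (λ j′ → h j (punchIn j j′)))
      ≡⟨ sumFin-offDiagonal-transpose h ⟩
    sumFin (λ j → sumFin (λ j′ → h (punchIn j j′) j))
      ≡⟨ sumFin-cong (λ j → sumFin-cong (λ j′ → anti j (punchIn j j′) (punchIn≢ j j′))) ⟩
    sumFin (λ j → sumFin (λ j′ → - h j (punchIn j j′)))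
      ≡⟨ sumFin-cong (λ j → sumFin-neg (λ j′ → h j (punchIn j j′))) ⟩
    sumFin (λ j → - sumFin (λ j′ → h j (punchIn j j′)))
      ≡⟨ sumFin-neg (λ j → sumFin (λ j′ → h j (punchIn j j′))) ⟩
    - sumFin (λ j → sumFin (λ j′ → h j (punchIn j j′))) ∎)
    where
    open ≡-Reasoning
    punchIn≢ : ∀ {n} (j : Fin (suc n)) j′ → j ≢ punchIn j j′
    punchIn≢ j j′ = FinP.punchInᵢ≢i j j′ ∘ sym

  if-does-yes : ∀ {P : Set} (p? : Dec P) {x y : ℤ} → P → (if does p? then x else y) ≡ x
  if-does-yes p? p rewrite dec-true p? p = refl

  if-does-no : ∀ {P : Set} (p? : Dec P) {x y : ℤ} → ¬ P → (if does p? then x else y) ≡ y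
  if-does-no p? ¬p rewrite dec-false p? ¬p = refl

  -- Determinants

  Matrix : ℕ → Set
  Matrix n = Fin n → Fin n → ℤ

  minor : ∀ {n} → Matrix (suc n) → Fin (suc n) → Matrix n
  minor M j a b = M (suc a) (punchIn j b)

  cofactorTerm : ∀ {n} → Matrix (suc n) → Fin (suc n) → ℤ
  cofactorTerm M j = (- + 1) ^ toℕ j * M zero j * det (minor M j)

  cofactorTerm-zeroEntry : ∀ {n} (M : Matrix (suc n)) j → M zero j ≡ + 0 → cofactorTerm M j ≡ + 0
  cofactorTerm-zeroEntry M j e = begin
    (- + 1) ^ toℕ j * M zero j * det (minor M j) ≡⟨ cong (λ x → (- + 1) ^ toℕ j * x * det (minor M j)) e ⟩
    (- + 1) ^ toℕ j * + 0 * det (minor M j)      ≡⟨ cong (_* det (minor M j)) (ℤP.*-zeroʳ ((- + 1) ^ toℕ j)) ⟩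
    + 0 * det (minor M j)                         ≡⟨ ℤP.*-zeroˡ (det (minor M j)) ⟩
    + 0                                           ∎
    where open ≡-Reasoning

  cofactorTerm-zeroMinor : ∀ {n} (M : Matrix (suc n)) j → det (minor M j) ≡ + 0 → cofactorTerm M j ≡ + 0
  cofactorTerm-zeroMinor M j e =
    trans (cong ((- + 1) ^ toℕ j * M zero j *_) e) (ℤP.*-zeroʳ ((- + 1) ^ toℕ j * M zero j))

  det-cong : ∀ {n} {M N : Matrix n} → (∀ i j → M i j ≡ N i j) → det M ≡ det N
  det-cong {zero}  e = refl
  det-cong {suc n} e = sumFin-cong (λ j →
    cong₂ _*_ (cong ((- + 1) ^ toℕ j *_) (e zero j)) (det-cong (λ a b → e (suc a) (punchIn j b))))

  det-zeroRow : ∀ {n} (M : Matrix n) p → (∀ j → M p j ≡ + 0) → det M ≡ + 0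
  det-zeroRow {suc n} M zero    e = sumFin-zero (cofactorTerm M) (λ j → cofactorTerm-zeroEntry M j (e j))
  det-zeroRow {suc n} M (suc p) e = sumFin-zero (cofactorTerm M) (λ j →
    cofactorTerm-zeroMinor M j (det-zeroRow (minor M j) p (λ b → e (punchIn j b))))

  det-zeroColumn : ∀ {n} (M : Matrix n) q → (∀ i → M i q ≡ + 0) → det M ≡ + 0
  det-zeroColumn {suc n} M q e = sumFin-zero (cofactorTerm M) term
    where
    term : ∀ j → cofactorTerm M j ≡ + 0
    term j with j FinP.≟ q
    ... | yes refl = cofactorTerm-zeroEntry M j (e zero)
    ... | no j≢q   = cofactorTerm-zeroMinor M j (det-zeroColumn (minor M j) (punchOut j≢q)
                       (λ a → trans (cong (M (suc a)) (FinP.punchIn-punchOut j≢q)) (e (suc a))))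

  det-identity : ∀ {n} (M : Matrix n) → (∀ a → M a a ≡ + 1) → (∀ a b → a ≢ b → M a b ≡ + 0) →
    det M ≡ + 1
  det-identity {zero}  M diag off = refl
  det-identity {suc n} M diag off = cong₂ _+_ leading rest
    where
    leading : cofactorTerm M zero ≡ + 1
    leading = begin
      + 1 * M zero zero * det (minor M zero) ≡⟨ cong (λ x → + 1 * x * det (minor M zero)) (diag zero) ⟩
      + 1 * + 1 * det (minor M zero)         ≡⟨ ℤP.*-identityˡ (det (minor M zero)) ⟩
      det (minor M zero)                     ≡⟨ det-identity (minor M zero) (diag ∘ suc)
                                                  (λ a b a≢b → off (suc a) (suc b) (a≢b ∘ FinP.suc-injective)) ⟩
      + 1                                    ∎
      where open ≡-Reasoning
    rest : sumFin (cofactorTerm M ∘ suc) ≡ + 0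
    rest = sumFin-zero (cofactorTerm M ∘ suc) (λ j → cofactorTerm-zeroEntry M (suc j) (off zero (suc j) (λ ())))

  sumFin-linear : ∀ {n} {f g h : Fin n → ℤ} (c : ℤ) → (∀ j → f j ≡ g j + c * h j) →
    sumFin f ≡ sumFin g + c * sumFin h
  sumFin-linear {g = g} {h} c e = trans (sumFin-cong e)
    (trans (sumFin-distrib-+ g (λ j → c * h j)) (cong (_+_ (sumFin g)) (sumFin-*ˡ c h)))

  det-linearRow : ∀ {n} (M M₁ M₂ : Matrix n) p (c : ℤ) →
    (∀ i j → i ≢ p → M i j ≡ M₁ i j) → (∀ i j → i ≢ p → M i j ≡ M₂ i j) →
    (∀ j → M p j ≡ M₁ p j + c * M₂ p j) → det M ≡ det M₁ + c * det M₂
  det-linearRow {suc n} M M₁ M₂ zero c e₁ e₂ ep =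
    sumFin-linear {f = cofactorTerm M} {cofactorTerm M₁} {cofactorTerm M₂} c term
    where
    distrib : ∀ s a b c d → s * (a + c * b) * d ≡ s * a * d + c * (s * b * d)
    distrib = solve-∀
    term : ∀ j → cofactorTerm M j ≡ cofactorTerm M₁ j + c * cofactorTerm M₂ j
    term j = let s = (- + 1) ^ toℕ j in begin
      s * M zero j * det (minor M j)
        ≡⟨ cong (λ x → s * x * det (minor M j)) (ep j) ⟩
      s * (M₁ zero j + c * M₂ zero j) * det (minor M j)
        ≡⟨ distrib s (M₁ zero j) (M₂ zero j) c (det (minor M j)) ⟩
      s * M₁ zero j * det (minor M j) + c * (s * M₂ zero j * det (minor M j))
        ≡⟨ cong₂ (λ x y → s * M₁ zero j * x + c * (s * M₂ zero j * y))
             (det-cong (λ a b → e₁ (suc a) _ (λ ()))) (det-cong (λ a b → e₂ (suc a) _ (λ ()))) ⟩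
      cofactorTerm M₁ j + c * cofactorTerm M₂ j ∎
      where open ≡-Reasoning
  det-linearRow {suc n} M M₁ M₂ (suc p) c e₁ e₂ ep =
    sumFin-linear {f = cofactorTerm M} {cofactorTerm M₁} {cofactorTerm M₂} c term
    where
    distrib : ∀ c s x d₁ d₂ → s * x * (d₁ + c * d₂) ≡ s * x * d₁ + c * (s * x * d₂)
    distrib = solve-∀
    term : ∀ j → cofactorTerm M j ≡ cofactorTerm M₁ j + c * cofactorTerm M₂ j
    term j = let s = (- + 1) ^ toℕ j in begin
      s * M zero j * det (minor M j)
        ≡⟨ cong (s * M zero j *_) (det-linearRow (minor M j) (minor M₁ j) (minor M₂ j) p c
             (λ a b a≢p → e₁ (suc a) _ (a≢p ∘ FinP.suc-injective))
             (λ a b a≢p → e₂ (suc a) _ (a≢p ∘ FinP.suc-injective)) (λ b → ep _)) ⟩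
      s * M zero j * (det (minor M₁ j) + c * det (minor M₂ j))
        ≡⟨ distrib c s (M zero j) (det (minor M₁ j)) (det (minor M₂ j)) ⟩
      s * M zero j * det (minor M₁ j) + c * (s * M zero j * det (minor M₂ j))
        ≡⟨ cong₂ (λ x y → s * x * det (minor M₁ j) + c * (s * y * det (minor M₂ j)))
             (e₁ zero j (λ ())) (e₂ zero j (λ ())) ⟩
      cofactorTerm M₁ j + c * cofactorTerm M₂ j ∎
      where open ≡-Reasoning

  punchIn-≥ : ∀ {n} (j : Fin (suc n)) (j′ : Fin n) → toℕ j ≤ toℕ j′ → punchIn j j′ ≡ suc j′
  punchIn-≥ zero    j′       _         = refl
  punchIn-≥ (suc j) (suc j′) (s≤s j≤j′) = cong suc (punchIn-≥ j j′ j≤j′)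

  toℕ-punchIn-< : ∀ {n} (j : Fin (suc n)) (j′ : Fin n) → toℕ j′ < toℕ j → toℕ (punchIn j j′) ≡ toℕ j′
  toℕ-punchIn-< (suc j) zero     _          = refl
  toℕ-punchIn-< (suc j) (suc j′) (s≤s j′<j) = cong suc (toℕ-punchIn-< j j′ j′<j)

  punchIn-punchIn-< : ∀ {n} (j : Fin (suc (suc n))) (j′ : Fin (suc n)) (b : Fin n) → toℕ j′ < toℕ j →
    punchIn j (punchIn j′ b) ≡ punchIn (punchIn j j′) (punchIn (pinch zero j) b)
  punchIn-punchIn-< (suc j)       zero     b       _          = refl
  punchIn-punchIn-< {suc n} (suc (suc j)) (suc j′) zero    (s≤s _)    = refl
  punchIn-punchIn-< {suc n} (suc (suc j)) (suc j′) (suc b) (s≤s j′<j) = cong suc (punchIn-punchIn-< (suc j) j′ b j′<j)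

  module FirstTwoRowsEqual {n : ℕ} (M : Matrix (suc (suc n))) (rows₀₁ : ∀ j → M zero j ≡ M (suc zero) j) where

    private
      x : Fin (suc (suc n)) → ℤ
      x = M zero

      s : ∀ {m} → Fin m → ℤ
      s j = (- + 1) ^ toℕ j

    -- For j < k, columns j and k are deleted, as are the first two rows.
    pairMinor< : Fin (suc (suc n)) → Fin (suc (suc n)) → ℤ
    pairMinor< j k = det (λ a b → M (suc (suc a)) (punchIn j (punchIn (pinch zero k) b)))

    pairMinor : Fin (suc (suc n)) → Fin (suc (suc n)) → ℤ
    pairMinor j k = if does (toℕ j ℕ.<? toℕ k) then pairMinor< j k else pairMinor< k j

    pairSign : Fin (suc (suc n)) → Fin (suc (suc n)) → ℤ
    pairSign j k =
      if does (toℕ k ℕ.<? toℕ j) then (- + 1) ^ (toℕ j ℕ.+ toℕ k) else - (- + 1) ^ (toℕ j ℕ.+ toℕ k)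

    pairTerm : Fin (suc (suc n)) → Fin (suc (suc n)) → ℤ
    pairTerm j k = pairSign j k * (x j * x k) * pairMinor j k

    s*s≡pairSign : ∀ j j′ → s j * s j′ ≡ pairSign j (punchIn j j′)
    s*s≡pairSign j j′ with toℕ j′ ℕ.<? toℕ j
    ... | yes j′<j = begin
      s j * s j′                       ≡⟨ ℤP.^-distribˡ-+-* (- + 1) (toℕ j) (toℕ j′) ⟨
      (- + 1) ^ (toℕ j ℕ.+ toℕ j′)     ≡⟨ cong (λ e → (- + 1) ^ (toℕ j ℕ.+ e)) (toℕ-punchIn-< j j′ j′<j) ⟨
      (- + 1) ^ (toℕ j ℕ.+ toℕ k)      ≡⟨ if-does-yes (toℕ k ℕ.<? toℕ j)
                                            (subst (_< toℕ j) (sym (toℕ-punchIn-< j j′ j′<j)) j′<j) ⟨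
      pairSign j k                     ∎
      where
      open ≡-Reasoning
      k = punchIn j j′
    ... | no j′≮j = begin
      s j * s j′                           ≡⟨ ℤP.^-distribˡ-+-* (- + 1) (toℕ j) (toℕ j′) ⟨
      (- + 1) ^ (toℕ j ℕ.+ toℕ j′)         ≡⟨ ℤP.neg-involutive _ ⟨
      - - (- + 1) ^ (toℕ j ℕ.+ toℕ j′)     ≡⟨ cong -_ (-1^-suc (toℕ j ℕ.+ toℕ j′)) ⟨
      - (- + 1) ^ suc (toℕ j ℕ.+ toℕ j′)   ≡⟨ cong (λ e → - (- + 1) ^ e) (ℕP.+-suc (toℕ j) (toℕ j′)) ⟨
      - (- + 1) ^ (toℕ j ℕ.+ toℕ (suc j′)) ≡⟨ if-does-no (toℕ (suc j′) ℕ.<? toℕ j)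
                                                (λ j′<j → j′≮j (ℕP.<-trans (ℕP.n<1+n _) j′<j)) ⟨
      pairSign j (suc j′)                  ≡⟨ cong (pairSign j) (punchIn-≥ j j′ (ℕP.≮⇒≥ j′≮j)) ⟨
      pairSign j (punchIn j j′)            ∎
      where open ≡-Reasoning

    minor-minor≡pairMinor : ∀ j j′ → det (minor (minor M j) j′) ≡ pairMinor j (punchIn j j′)
    minor-minor≡pairMinor j j′ with toℕ j′ ℕ.<? toℕ j
    ... | yes j′<j = begin
      det (minor (minor M j) j′) ≡⟨ det-cong (λ a b → cong (M (suc (suc a))) (punchIn-punchIn-< j j′ b j′<j)) ⟩
      pairMinor< k j             ≡⟨ if-does-no (toℕ j ℕ.<? toℕ k) (ℕP.<-asym k<j) ⟨
      pairMinor j k              ∎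
      where
      open ≡-Reasoning
      k = punchIn j j′
      k<j = subst (_< toℕ j) (sym (toℕ-punchIn-< j j′ j′<j)) j′<j
    ... | no j′≮j = begin
      det (minor (minor M j) j′) ≡⟨ if-does-yes (toℕ j ℕ.<? toℕ (suc j′)) (s≤s (ℕP.≮⇒≥ j′≮j)) ⟨
      pairMinor j (suc j′)       ≡⟨ cong (pairMinor j) (punchIn-≥ j j′ (ℕP.≮⇒≥ j′≮j)) ⟨
      pairMinor j (punchIn j j′) ∎
      where open ≡-Reasoning

    expansionTerm≡pairTerm : ∀ j j′ → s j * x j * cofactorTerm (minor M j) j′ ≡ pairTerm j (punchIn j j′)
    expansionTerm≡pairTerm j j′ = begin
      s j * x j * (s j′ * M (suc zero) k * det (minor (minor M j) j′))
        ≡⟨ cong (λ y → s j * x j * (s j′ * y * det (minor (minor M j) j′))) (sym (rows₀₁ k)) ⟩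
      s j * x j * (s j′ * x k * det (minor (minor M j) j′))
        ≡⟨ regroup (s j) (s j′) (x j) (x k) (det (minor (minor M j) j′)) ⟩
      s j * s j′ * (x j * x k) * det (minor (minor M j) j′)
        ≡⟨ cong₂ (λ σ D → σ * (x j * x k) * D) (s*s≡pairSign j j′) (minor-minor≡pairMinor j j′) ⟩
      pairTerm j k ∎
      where
      open ≡-Reasoning
      k = punchIn j j′
      regroup : ∀ a b c d f → a * c * (b * d * f) ≡ a * b * (c * d) * f
      regroup = solve-∀

    pairTerm-antisym : ∀ j k → j ≢ k → pairTerm k j ≡ - pairTerm j k
    pairTerm-antisym j k j≢k with ℕP.<-cmp (toℕ j) (toℕ k)
    ... | tri≈ _ j≡k _ = ⊥-elim (j≢k (FinP.toℕ-injective j≡k))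
    ... | tri< j<k _ k≮j = begin
      pairSign k j * (x k * x j) * pairMinor k j
        ≡⟨ cong₂ (λ σ D → σ * (x k * x j) * D)
             (trans (if-does-yes (toℕ j ℕ.<? toℕ k) j<k) (cong ((- + 1) ^_) (ℕP.+-comm (toℕ k) (toℕ j))))
             (if-does-no (toℕ k ℕ.<? toℕ j) k≮j) ⟩
      σ * (x k * x j) * pairMinor< j k
        ≡⟨ flip σ (x j) (x k) (pairMinor< j k) ⟩
      - (- σ * (x j * x k) * pairMinor< j k)
        ≡⟨ cong -_ (cong₂ (λ σ′ D → σ′ * (x j * x k) * D)
             (sym (if-does-no (toℕ k ℕ.<? toℕ j) k≮j)) (sym (if-does-yes (toℕ j ℕ.<? toℕ k) j<k))) ⟩
      - pairTerm j k ∎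
      where
      open ≡-Reasoning
      σ = (- + 1) ^ (toℕ j ℕ.+ toℕ k)
      flip : ∀ σ a b D → σ * (b * a) * D ≡ - (- σ * (a * b) * D)
      flip = solve-∀
    ... | tri> j≮k _ k<j = begin
      pairSign k j * (x k * x j) * pairMinor k j
        ≡⟨ cong₂ (λ σ D → σ * (x k * x j) * D)
             (if-does-no (toℕ j ℕ.<? toℕ k) j≮k) (if-does-yes (toℕ k ℕ.<? toℕ j) k<j) ⟩
      - σ * (x k * x j) * pairMinor< k j
        ≡⟨ flip σ (x j) (x k) (pairMinor< k j) ⟩
      - (σ * (x j * x k) * pairMinor< k j)
        ≡⟨ cong -_ (cong₂ (λ σ′ D → σ′ * (x j * x k) * D)
             (trans (cong ((- + 1) ^_) (ℕP.+-comm (toℕ k) (toℕ j))) (sym (if-does-yes (toℕ k ℕ.<? toℕ j) k<j)))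
             (sym (if-does-no (toℕ j ℕ.<? toℕ k) j≮k))) ⟩
      - pairTerm j k ∎
      where
      open ≡-Reasoning
      σ = (- + 1) ^ (toℕ k ℕ.+ toℕ j)
      flip : ∀ σ a b D → - σ * (b * a) * D ≡ - (σ * (a * b) * D)
      flip = solve-∀

    det≡0 : det M ≡ + 0
    det≡0 = begin
      det M
        ≡⟨ sumFin-cong (λ j → sym (sumFin-*ˡ (s j * x j) (cofactorTerm (minor M j)))) ⟩
      sumFin (λ j → sumFin (λ j′ → s j * x j * cofactorTerm (minor M j) j′))
        ≡⟨ sumFin-cong (λ j → sumFin-cong (expansionTerm≡pairTerm j)) ⟩
      sumFin (λ j → sumFin (λ j′ → pairTerm j (punchIn j j′)))
        ≡⟨ sumFin-offDiagonal-antisym pairTerm pairTerm-antisym ⟩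
      + 0 ∎
      where open ≡-Reasoning

  det-equalAdjacentRows : ∀ {n} (M : Matrix n) p p′ → toℕ p′ ≡ suc (toℕ p) →
    (∀ j → M p j ≡ M p′ j) → det M ≡ + 0
  det-equalAdjacentRows {suc (suc n)} M zero    (suc zero) _ eq = FirstTwoRowsEqual.det≡0 M eq
  det-equalAdjacentRows {suc n}       M (suc p) (suc p′)   e eq = sumFin-zero (cofactorTerm M) (λ j →
    cofactorTerm-zeroMinor M j
      (det-equalAdjacentRows (minor M j) p p′ (ℕP.suc-injective e) (λ b → eq (punchIn j b))))

  Adjacent : ∀ {n} → Fin n → Fin n → Set
  Adjacent p p′ = toℕ p′ ≡ suc (toℕ p) ⊎ toℕ p ≡ suc (toℕ p′)

  Adjacent⇒≢ : ∀ {n} {p p′ : Fin n} → Adjacent p p′ → p ≢ p′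
  Adjacent⇒≢ (inj₁ e) refl = ℕP.1+n≢n (sym e)
  Adjacent⇒≢ (inj₂ e) refl = ℕP.1+n≢n (sym e)

  replaceRow : ∀ {n} → Matrix n → Fin n → (Fin n → ℤ) → Matrix n
  replaceRow M p v i j = if does (i FinP.≟ p) then v j else M i j

  replaceRow-≡ : ∀ {n} (M : Matrix n) p v j → replaceRow M p v p j ≡ v j
  replaceRow-≡ M p v j = if-does-yes (p FinP.≟ p) refl

  replaceRow-≢ : ∀ {n} (M : Matrix n) p v i j → i ≢ p → replaceRow M p v i j ≡ M i j
  replaceRow-≢ M p v i j i≢p = if-does-no (i FinP.≟ p) i≢p

  -- The change is linear in row p′, and the increment is a matrix with rows p and p′ equal.
  det-addAdjacentRow : ∀ {n} (M M′ : Matrix n) p p′ → Adjacent p p′ → (c : ℤ) →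
    (∀ i j → i ≢ p′ → M′ i j ≡ M i j) → (∀ j → M′ p′ j ≡ M p′ j + c * M p j) → det M′ ≡ det M
  det-addAdjacentRow M M′ p p′ adj c others row = begin
    det M′            ≡⟨ det-linearRow M′ M M″ p′ c others
                           (λ i j i≢p′ → trans (others i j i≢p′) (sym (replaceRow-≢ M p′ (M p) i j i≢p′)))
                           (λ j → trans (row j) (cong (λ y → M p′ j + c * y) (sym (replaceRow-≡ M p′ (M p) j)))) ⟩
    det M + c * det M″ ≡⟨ cong (λ d → det M + c * d) (det-M″ adj) ⟩
    det M + c * + 0   ≡⟨ cong (_+_ (det M)) (ℤP.*-zeroʳ c) ⟩
    det M + + 0       ≡⟨ ℤP.+-identityʳ (det M) ⟩
    det M             ∎
    where
    open ≡-Reasoning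
    M″ = replaceRow M p′ (M p)
    rows : ∀ j → M″ p j ≡ M″ p′ j
    rows j = trans (replaceRow-≢ M p′ (M p) p j (Adjacent⇒≢ adj)) (sym (replaceRow-≡ M p′ (M p) j))
    det-M″ : Adjacent p p′ → det M″ ≡ + 0
    det-M″ (inj₁ e) = det-equalAdjacentRows M″ p p′ e rows
    det-M″ (inj₂ e) = det-equalAdjacentRows M″ p′ p e (sym ∘ rows)

  Adjacentℕ : ℕ → ℕ → Set
  Adjacentℕ t u = u ≡ suc t ⊎ t ≡ suc u

  Adjacentℕ-sym : ∀ {t u} → Adjacentℕ t u → Adjacentℕ u t
  Adjacentℕ-sym (inj₁ e) = inj₂ e
  Adjacentℕ-sym (inj₂ e) = inj₁ e

  Adjacentℕ⇒≢ : ∀ {t u} → Adjacentℕ t u → t ≢ u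
  Adjacentℕ⇒≢ (inj₁ e) refl = ℕP.1+n≢n (sym e)
  Adjacentℕ⇒≢ (inj₂ e) refl = ℕP.1+n≢n (sym e)

  module _ {n} {f : Fin n → ℕ} (inc : StrictlyIncreasing f) where

    strictlyIncreasing-injective : ∀ i j → f i ≡ f j → i ≡ j
    strictlyIncreasing-injective i j e with ℕP.<-cmp (toℕ i) (toℕ j)
    ... | tri< i<j _ _ = ⊥-elim (ℕP.<-irrefl e (inc i j i<j))
    ... | tri≈ _ i≡j _ = FinP.toℕ-injective i≡j
    ... | tri> _ _ j<i = ⊥-elim (ℕP.<-irrefl (sym e) (inc j i j<i))

    strictlyIncreasing-mono-≤ : ∀ i j → toℕ i ≤ toℕ j → f i ≤ f j
    strictlyIncreasing-mono-≤ i j i≤j with ℕP.m≤n⇒m<n∨m≡n i≤j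
    ... | inj₁ i<j = ℕP.<⇒≤ (inc i j i<j)
    ... | inj₂ i≡j = ℕP.≤-reflexive (cong f (FinP.toℕ-injective i≡j))

    strictlyIncreasing-cancel-< : ∀ i j → f i < f j → toℕ i < toℕ j
    strictlyIncreasing-cancel-< i j fi<fj =
      ℕP.≰⇒> (λ j≤i → ℕP.<⇒≱ fi<fj (strictlyIncreasing-mono-≤ j i j≤i))

    strictlyIncreasing-adjacent : ∀ i j → Adjacentℕ (f i) (f j) → Adjacent i j
    strictlyIncreasing-adjacent i j (inj₁ e) = inj₁ (successor i j e)
      where
      successor : ∀ i j → f j ≡ suc (f i) → toℕ j ≡ suc (toℕ i)
      successor i j e with strictlyIncreasing-cancel-< i j (subst (f i <_) (sym e) (ℕP.n<1+n _))
      ... | i<j with ℕP.<-cmp (toℕ j) (suc (toℕ i))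
      ... | tri≈ _ j≡1+i _ = j≡1+i
      ... | tri< j<1+i _ _ = ⊥-elim (ℕP.<-irrefl refl (ℕP.<-≤-trans j<1+i i<j))
      ... | tri> _ _ 1+i<j = ⊥-elim (ℕP.<-irrefl refl (ℕP.<-≤-trans fc<fj (subst (_≤ f c) (sym e) fi<fc)))
        where
        c = fromℕ< (ℕP.<-trans 1+i<j (FinP.toℕ<n j))
        c≡1+i = FinP.toℕ-fromℕ< (ℕP.<-trans 1+i<j (FinP.toℕ<n j))
        fi<fc = inc i c (subst (toℕ i <_) (sym c≡1+i) (ℕP.n<1+n _))
        fc<fj = inc c j (subst (_< toℕ j) (sym c≡1+i) 1+i<j)
    strictlyIncreasing-adjacent i j (inj₂ e) =
      Adjacent-sym (strictlyIncreasing-adjacent j i (inj₁ e))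
      where
      Adjacent-sym : ∀ {p p′ : Fin n} → Adjacent p p′ → Adjacent p′ p
      Adjacent-sym (inj₁ e) = inj₂ e
      Adjacent-sym (inj₂ e) = inj₁ e

  strictlyIncreasing-unique : ∀ {n} {f g : Fin n → ℕ} → StrictlyIncreasing f → StrictlyIncreasing g →
    (∀ a → ∃ λ b → f a ≡ g b) → (∀ b → ∃ λ a → g b ≡ f a) → ∀ a → f a ≡ g a
  strictlyIncreasing-unique {suc n} {f} {g} f-inc g-inc f⊆g g⊆f = λ where
      zero    → f₀≡g₀
      (suc a) → strictlyIncreasing-unique (λ i j i<j → f-inc (suc i) (suc j) (s≤s i<j))
                  (λ i j i<j → g-inc (suc i) (suc j) (s≤s i<j)) f⊆g′ g⊆f′ a
    where
    f₀≡g₀ : f zero ≡ g zero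
    f₀≡g₀ = ℕP.≤-antisym
      (ℕP.≤-trans (strictlyIncreasing-mono-≤ f-inc zero (proj₁ (g⊆f zero)) z≤n)
                  (ℕP.≤-reflexive (sym (proj₂ (g⊆f zero)))))
      (ℕP.≤-trans (strictlyIncreasing-mono-≤ g-inc zero (proj₁ (f⊆g zero)) z≤n)
                  (ℕP.≤-reflexive (sym (proj₂ (f⊆g zero)))))
    f⊆g′ : ∀ a → ∃ λ b → f (suc a) ≡ g (suc b)
    f⊆g′ a with f⊆g (suc a)
    ... | zero , e  = ⊥-elim (ℕP.<-irrefl (trans f₀≡g₀ (sym e)) (f-inc zero (suc a) (s≤s z≤n)))
    ... | suc b , e = b , e
    g⊆f′ : ∀ b → ∃ λ a → g (suc b) ≡ f (suc a)
    g⊆f′ b with g⊆f (suc b)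
    ... | zero , e  = ⊥-elim (ℕP.<-irrefl (trans (sym f₀≡g₀) (sym e)) (g-inc zero (suc b) (s≤s z≤n)))
    ... | suc a , e = a , e

  _[_]≔_ : ∀ {n} → (Fin n → ℕ) → Fin n → ℕ → Fin n → ℕ
  f [ p ]≔ u = updateAt f p (λ _ → u)

  []≔-all : ∀ {n} (P : ℕ → Set) (f : Fin n → ℕ) p {u} → P u → (∀ i → P (f i)) → ∀ i → P ((f [ p ]≔ u) i)
  []≔-all P f p {u} Pu Pf i with i FinP.≟ p
  ... | yes refl = subst P (sym (updateAt-updates i {λ _ → u} f)) Pu
  ... | no i≢p   = subst P (sym (updateAt-minimal i p {λ _ → u} f i≢p)) (Pf i)

  []≔-strictlyIncreasing : ∀ {n} {f : Fin n → ℕ} → StrictlyIncreasing f → ∀ {p t u} → f p ≡ t →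
    Adjacentℕ t u → (∀ i → f i ≢ u) → StrictlyIncreasing (f [ p ]≔ u)
  []≔-strictlyIncreasing {f = f} inc {p} {t} {u} fp≡t adj free i j i<j with i FinP.≟ p | j FinP.≟ p
  ... | yes refl | yes refl = ⊥-elim (ℕP.<-irrefl refl i<j)
  ... | yes refl | no j≢p
    rewrite updateAt-updates i {λ _ → u} f | updateAt-minimal j i {λ _ → u} f j≢p = below adj
    where
    t<fj : t < f j
    t<fj = subst (_< f j) fp≡t (inc p j i<j)
    below : Adjacentℕ t u → u < f j
    below (inj₁ e) = ℕP.≤∧≢⇒< (subst (_≤ f j) (sym e) t<fj) (λ u≡fj → free j (sym u≡fj))
    below (inj₂ e) = ℕP.<-trans (subst (u <_) (sym e) (ℕP.n<1+n u)) t<fj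
  ... | no i≢p | yes refl
    rewrite updateAt-updates j {λ _ → u} f | updateAt-minimal i j {λ _ → u} f i≢p = above adj
    where
    fi<t : f i < t
    fi<t = subst (f i <_) fp≡t (inc i p i<j)
    above : Adjacentℕ t u → f i < u
    above (inj₁ e) = ℕP.<-trans fi<t (subst (t <_) (sym e) (ℕP.n<1+n t))
    above (inj₂ e) = ℕP.≤∧≢⇒< (ℕP.≤-pred (subst (f i <_) e fi<t)) (free i)
  ... | no i≢p | no j≢p
    rewrite updateAt-minimal i p {λ _ → u} f i≢p | updateAt-minimal j p {λ _ → u} f j≢p = inc i j i<j

  _∈ᵣ_ : ∀ {a} → ℕ → (Fin a → ℕ) → Set
  x ∈ᵣ f = ∃ λ i → x ≡ f i

  _∈ᵣ?_ : ∀ {a} x (f : Fin a → ℕ) → Dec (x ∈ᵣ f)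
  x ∈ᵣ? f = FinP.any? (λ i → x ℕ.≟ f i)

  record Complementary {k m : ℕ} (L : ℕ) (r : Fin k → ℕ) (rbar : Fin m → ℕ) : Set where
    field
      increasing : StrictlyIncreasing r
      ≥1         : ∀ i → 1 ≤ r i
      ≤L         : ∀ i → r i ≤ L
      complement : IsComplementEnum L r rbar

    complement-increasing : StrictlyIncreasing rbar
    complement-increasing = proj₁ complement

    complement-≥1 : ∀ i → 1 ≤ rbar i
    complement-≥1 i = proj₁ (proj₁ (proj₂ complement) i)

    complement-≤L : ∀ i → rbar i ≤ L
    complement-≤L i = proj₁ (proj₂ (proj₁ (proj₂ complement) i))

    complement-disjoint : ∀ i j → rbar i ≢ r j
    complement-disjoint i j = proj₂ (proj₂ (proj₁ (proj₂ complement) i)) j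

    complement-covers : ∀ x → 1 ≤ x → x ≤ L → (∀ j → x ≢ r j) → ∃ λ i → rbar i ≡ x
    complement-covers = proj₂ (proj₂ complement)

    ∈-or-∈complement : ∀ x → 1 ≤ x → x ≤ L → x ∈ᵣ r ⊎ x ∈ᵣ rbar
    ∈-or-∈complement x 1≤x x≤L with x ∈ᵣ? r
    ... | yes x∈r = inj₁ x∈r
    ... | no x∉r with complement-covers x 1≤x x≤L (λ j e → x∉r (j , e))
    ...   | i , rbari≡x = inj₂ (i , sym rbari≡x)

  Complementary-swap : ∀ {k m L} {r : Fin k → ℕ} {rbar : Fin m → ℕ} → Complementary L r rbar →
    ∀ {p q t u} → r p ≡ t → rbar q ≡ u → Adjacentℕ t u → Complementary L (r [ p ]≔ u) (rbar [ q ]≔ t)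
  Complementary-swap {k} {m} {L} {r} {rbar} V {p} {q} {t} {u} rp≡t rbarq≡u adj = record
    { increasing = []≔-strictlyIncreasing increasing rp≡t adj (λ i e → complement-disjoint q i (trans rbarq≡u (sym e)))
    ; ≥1         = []≔-all (1 ≤_) r p (subst (1 ≤_) rbarq≡u (complement-≥1 q)) ≥1
    ; ≤L         = []≔-all (_≤ L) r p (subst (_≤ L) rbarq≡u (complement-≤L q)) ≤L
    ; complement =
        []≔-strictlyIncreasing complement-increasing rbarq≡u (Adjacentℕ-sym adj)
          (λ i e → complement-disjoint i p (trans e (sym rp≡t)))
      , (λ i → []≔-all (1 ≤_) rbar q (subst (1 ≤_) rp≡t (≥1 p)) complement-≥1 i
             , []≔-all (_≤ L) rbar q (subst (_≤ L) rp≡t (≤L p)) complement-≤L i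
             , disjoint i)
      , covers
    }
    where
    open Complementary V
    r′ = r [ p ]≔ u
    rbar′ = rbar [ q ]≔ t
    disjoint : ∀ i j → rbar′ i ≢ r′ j
    disjoint i j with i FinP.≟ q | j FinP.≟ p
    ... | yes refl | yes refl
      rewrite updateAt-updates i {λ _ → t} rbar | updateAt-updates j {λ _ → u} r = Adjacentℕ⇒≢ adj
    ... | yes refl | no j≢p
      rewrite updateAt-updates i {λ _ → t} rbar | updateAt-minimal j p {λ _ → u} r j≢p =
        λ t≡rj → j≢p (strictlyIncreasing-injective increasing j p (trans (sym t≡rj) (sym rp≡t)))
    ... | no i≢q | yes refl
      rewrite updateAt-minimal i q {λ _ → t} rbar i≢q | updateAt-updates j {λ _ → u} r =
        λ rbari≡u → i≢q (strictlyIncreasing-injective complement-increasing i q (trans rbari≡u (sym rbarq≡u)))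
    ... | no i≢q | no j≢p
      rewrite updateAt-minimal i q {λ _ → t} rbar i≢q | updateAt-minimal j p {λ _ → u} r j≢p =
        complement-disjoint i j
    covers : ∀ x → 1 ≤ x → x ≤ L → (∀ j → x ≢ r′ j) → ∃ λ i → rbar′ i ≡ x
    covers x 1≤x x≤L x∉r′ with x ℕ.≟ t
    ... | yes refl = q , updateAt-updates q rbar
    ... | no x≢t with complement-covers x 1≤x x≤L x∉r
      where
      x∉r : ∀ j → x ≢ r j
      x∉r j x≡rj with j FinP.≟ p
      ... | yes refl = x≢t (trans x≡rj rp≡t)
      ... | no j≢p   = x∉r′ j (trans x≡rj (sym (updateAt-minimal j p {λ _ → u} r j≢p)))
    ... | i , rbari≡x = i , trans (updateAt-minimal i q rbar i≢q) rbari≡x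
      where
      i≢q : i ≢ q
      i≢q refl = x∉r′ p (trans (sym rbari≡x) (trans rbarq≡u (sym (updateAt-updates p r))))

  -- Complementary minors

  ∣sumFin-+∣ : ∀ {m} (g : Fin m → ℕ) → ∣ sumFin (λ i → + g i) ∣ ≡ ℕΣ.sum g
  ∣sumFin-+∣ g = cong ∣_∣ (lift g)
    where
    lift : ∀ {m} (g : Fin m → ℕ) → sumFin (λ i → + g i) ≡ + ℕΣ.sum g
    lift {zero}  g = refl
    lift {suc m} g = cong (_+_ (+ g zero)) (lift (g ∘ suc))

  sum-increment : ∀ {m} (g g′ : Fin (suc m) → ℕ) q → g′ q ≡ suc (g q) → (∀ i → i ≢ q → g′ i ≡ g i) →
    ℕΣ.sum g′ ≡ suc (ℕΣ.sum g)
  sum-increment g g′ q g′q others = begin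
    ℕΣ.sum g′                             ≡⟨ ℕΣ.sum-remove g′ ⟩
    g′ q ℕ.+ ℕΣ.sum (g′ ∘ punchIn q)      ≡⟨ cong₂ ℕ._+_ g′q
                                               (ℕΣ.sum-cong-≗ (λ i → others (punchIn q i) (FinP.punchInᵢ≢i q i))) ⟩
    suc (g q ℕ.+ ℕΣ.sum (g ∘ punchIn q))  ≡⟨ cong suc (ℕΣ.sum-remove g) ⟨
    suc (ℕΣ.sum g)                        ∎
    where open ≡-Reasoning

  complementSign : ∀ {m} → (Fin m → ℕ) → (Fin m → ℕ) → ℤ
  complementSign rbar sbar = (- + 1) ^ ∣ sumFin (λ i → + (rbar i ℕ.+ sbar i)) ∣

  complementSign-swap : ∀ {m} (rbar sbar : Fin m → ℕ) q {t u} → rbar q ≡ u → Adjacentℕ t u →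
    complementSign (rbar [ q ]≔ t) sbar ≡ - complementSign rbar sbar
  complementSign-swap {suc m} rbar sbar q {t} {u} rbarq≡u adj
    rewrite ∣sumFin-+∣ (λ i → (rbar [ q ]≔ t) i ℕ.+ sbar i) | ∣sumFin-+∣ (λ i → rbar i ℕ.+ sbar i) = flip adj
    where
    g g′ : Fin (suc m) → ℕ
    g i = rbar i ℕ.+ sbar i
    g′ i = (rbar [ q ]≔ t) i ℕ.+ sbar i
    g′q≡t+sbar : g′ q ≡ t ℕ.+ sbar q
    g′q≡t+sbar = cong (ℕ._+ sbar q) (updateAt-updates q rbar)
    others : ∀ i → i ≢ q → g′ i ≡ g i
    others i i≢q = cong (ℕ._+ sbar i) (updateAt-minimal i q rbar i≢q)
    flip : Adjacentℕ t u → (- + 1) ^ ℕΣ.sum g′ ≡ - (- + 1) ^ ℕΣ.sum g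
    flip (inj₁ u≡1+t) = begin
      (- + 1) ^ ℕΣ.sum g′         ≡⟨ ℤP.neg-involutive _ ⟨
      - - (- + 1) ^ ℕΣ.sum g′     ≡⟨ cong -_ (-1^-suc (ℕΣ.sum g′)) ⟨
      - (- + 1) ^ suc (ℕΣ.sum g′) ≡⟨ cong (λ e → - (- + 1) ^ e) (sum-increment g′ g q
                                       (trans (cong (ℕ._+ sbar q) (trans rbarq≡u u≡1+t)) (cong suc (sym g′q≡t+sbar)))
                                       (λ i i≢q → sym (others i i≢q))) ⟨
      - (- + 1) ^ ℕΣ.sum g        ∎
      where open ≡-Reasoning
    flip (inj₂ t≡1+u) = begin
      (- + 1) ^ ℕΣ.sum g′        ≡⟨ cong ((- + 1) ^_) (sum-increment g g′ q
                                      (trans g′q≡t+sbar (cong (ℕ._+ sbar q) (trans t≡1+u (cong suc (sym rbarq≡u))))) others) ⟩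
      (- + 1) ^ suc (ℕΣ.sum g)    ≡⟨ -1^-suc (ℕΣ.sum g) ⟩
      - (- + 1) ^ ℕΣ.sum g        ∎
      where open ≡-Reasoning

  complementSign-diagonal : ∀ {m} (rbar sbar : Fin m → ℕ) → (∀ i → rbar i ≡ sbar i) →
    complementSign rbar sbar ≡ + 1
  complementSign-diagonal rbar sbar rbar≗sbar = begin
    (- + 1) ^ ∣ sumFin (λ i → + (rbar i ℕ.+ sbar i)) ∣  ≡⟨ cong ((- + 1) ^_) (∣sumFin-+∣ (λ i → rbar i ℕ.+ sbar i)) ⟩
    (- + 1) ^ ℕΣ.sum (λ i → rbar i ℕ.+ sbar i)        ≡⟨ cong ((- + 1) ^_)
                                                           (ℕΣ.sum-cong-≗ (λ i → cong (rbar i ℕ.+_) (sym (rbar≗sbar i)))) ⟩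
    (- + 1) ^ ℕΣ.sum (λ i → rbar i ℕ.+ rbar i)        ≡⟨ cong ((- + 1) ^_) (ℕΣ.∑-distrib-+ rbar rbar) ⟩
    (- + 1) ^ (ℕΣ.sum rbar ℕ.+ ℕΣ.sum rbar)           ≡⟨ -1^-double (ℕΣ.sum rbar) ⟩
    + 1                                               ∎
    where open ≡-Reasoning

  ℕMatrix : Set
  ℕMatrix = ℕ → ℕ → ℤ

  submatrix : ∀ {a} → ℕMatrix → (Fin a → ℕ) → (Fin a → ℕ) → Matrix a
  submatrix M r s i j = M (r i) (s j)

  addRow : ℕ → ℕ → ℤ → ℕMatrix → ℕMatrix
  addRow t u c M x y = if does (x ℕ.≟ t) then M t y + c * M u y else M x y

  addRow-≡ : ∀ t u c M y → addRow t u c M t y ≡ M t y + c * M u y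
  addRow-≡ t u c M y = if-does-yes (t ℕ.≟ t) refl

  addRow-≢ : ∀ t u c M x y → x ≢ t → addRow t u c M x y ≡ M x y
  addRow-≢ t u c M x y x≢t = if-does-no (x ℕ.≟ t) x≢t

  det-addRow-untouched : ∀ {a} (f s : Fin a → ℕ) t u c M → (∀ i → f i ≢ t) →
    det (submatrix (addRow t u c M) f s) ≡ det (submatrix M f s)
  det-addRow-untouched f s t u c M t∉f = det-cong (λ i j → addRow-≢ t u c M (f i) (s j) (t∉f i))

  det-addRow-both : ∀ {a} {f : Fin a → ℕ} (s : Fin a → ℕ) → StrictlyIncreasing f → ∀ t u c M → Adjacentℕ t u →
    ∀ {p q} → f p ≡ t → f q ≡ u → det (submatrix (addRow t u c M) f s) ≡ det (submatrix M f s)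
  det-addRow-both {f = f} s inc t u c M adj {p} {q} fp≡t fq≡u =
    det-addAdjacentRow (submatrix M f s) (submatrix (addRow t u c M) f s) q p
      (strictlyIncreasing-adjacent inc q p (subst₂ Adjacentℕ (sym fq≡u) (sym fp≡t) (Adjacentℕ-sym adj))) c
      (λ i j i≢p → addRow-≢ t u c M (f i) (s j)
                     (λ fi≡t → i≢p (strictlyIncreasing-injective inc i p (trans fi≡t (sym fp≡t)))))
      (λ j → trans (cong (λ x → addRow t u c M x (s j)) fp≡t)
               (trans (addRow-≡ t u c M (s j)) (cong₂ (λ x y → M x (s j) + c * M y (s j)) (sym fp≡t) (sym fq≡u))))

  det-addRow-split : ∀ {a} {f : Fin a → ℕ} (s : Fin a → ℕ) → StrictlyIncreasing f → ∀ t u c M →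
    ∀ {p} → f p ≡ t →
    det (submatrix (addRow t u c M) f s) ≡ det (submatrix M f s) + c * det (submatrix M (f [ p ]≔ u) s)
  det-addRow-split {f = f} s inc t u c M {p} fp≡t =
    det-linearRow (submatrix (addRow t u c M) f s) (submatrix M f s) (submatrix M (f [ p ]≔ u) s) p c
      unchanged
      (λ i j i≢p → trans (unchanged i j i≢p) (cong (λ x → M x (s j)) (sym (updateAt-minimal i p f i≢p))))
      (λ j → trans (cong (λ x → addRow t u c M x (s j)) fp≡t)
               (trans (addRow-≡ t u c M (s j))
                 (cong₂ (λ x y → M x (s j) + c * M y (s j)) (sym fp≡t) (sym (updateAt-updates p f)))))
    where
    unchanged : ∀ i j → i ≢ p → addRow t u c M (f i) (s j) ≡ M (f i) (s j)
    unchanged i j i≢p = addRow-≢ t u c M (f i) (s j)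
      (λ fi≡t → i≢p (strictlyIncreasing-injective inc i p (trans fi≡t (sym fp≡t))))

  det-addRow-source : ∀ {a} {f : Fin a → ℕ} (s : Fin a → ℕ) → StrictlyIncreasing f → ∀ t u c M → Adjacentℕ t u →
    ∀ {q} → f q ≡ u → det (submatrix (addRow t u c M) f s) ≡ det (submatrix M f s)
  det-addRow-source {f = f} s inc t u c M adj fq≡u with FinP.any? (λ i → f i ℕ.≟ t)
  ... | yes (p , fp≡t) = det-addRow-both s inc t u c M adj fp≡t fq≡u
  ... | no t∉f         = det-addRow-untouched f s t u c M (λ i fi≡t → t∉f (i , fi≡t))

  MinorDuality : ℕ → ℕ → ℕMatrix → ℕMatrix → Set
  MinorDuality k m M P = ∀ (r s : Fin k → ℕ) (rbar sbar : Fin m → ℕ) →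
    Complementary (k ℕ.+ m) r rbar → Complementary (k ℕ.+ m) s sbar →
    det (submatrix M r s) ≡ complementSign rbar sbar * det (submatrix P rbar sbar)

  -- Exchanging t ∈ r with the adjacent u ∈ rbar gives the second summand of det-addRow-split,
  -- with the opposite complement sign.
  MinorDuality-addRow-exchange : ∀ {k m} t u c M P → Adjacentℕ t u → MinorDuality k m M P →
    ∀ r s rbar sbar → Complementary (k ℕ.+ m) r rbar → Complementary (k ℕ.+ m) s sbar →
    ∀ {p q} → r p ≡ t → rbar q ≡ u →
    det (submatrix (addRow t u c M) r s) ≡ complementSign rbar sbar * det (submatrix (addRow u t (- c) P) rbar sbar)
  MinorDuality-addRow-exchange t u c M P adj dual r s rbar sbar Vr Vs {p} {q} rp≡t rbarq≡u = begin
    det (submatrix (addRow t u c M) r s)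
      ≡⟨ det-addRow-split s increasing t u c M rp≡t ⟩
    det (submatrix M r s) + c * det (submatrix M r′ s)
      ≡⟨ cong₂ (λ x y → x + c * y) (dual r s rbar sbar Vr Vs)
           (dual r′ s rbar′ sbar (Complementary-swap Vr rp≡t rbarq≡u adj) Vs) ⟩
    ε * det (submatrix P rbar sbar) + c * (complementSign rbar′ sbar * det (submatrix P rbar′ sbar))
      ≡⟨ cong (λ σ → ε * det (submatrix P rbar sbar) + c * (σ * det (submatrix P rbar′ sbar)))
           (complementSign-swap rbar sbar q rbarq≡u adj) ⟩
    ε * det (submatrix P rbar sbar) + c * (- ε * det (submatrix P rbar′ sbar))
      ≡⟨ factor ε (det (submatrix P rbar sbar)) (det (submatrix P rbar′ sbar)) c ⟩
    ε * (det (submatrix P rbar sbar) + - c * det (submatrix P rbar′ sbar))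
      ≡⟨ cong (ε *_) (det-addRow-split sbar complement-increasing u t (- c) P rbarq≡u) ⟨
    ε * det (submatrix (addRow u t (- c) P) rbar sbar) ∎
    where
    open ≡-Reasoning
    open Complementary Vr
    ε = complementSign rbar sbar
    r′ = r [ p ]≔ u
    rbar′ = rbar [ q ]≔ t
    factor : ∀ e X X′ c → e * X + c * (- e * X′) ≡ e * (X + - c * X′)
    factor = solve-∀

  -- addRow u t (- c) is the inverse transpose of addRow t u c.
  MinorDuality-addRow : ∀ {k m} t u c M P → Adjacentℕ t u →
    1 ≤ t → t ≤ k ℕ.+ m → 1 ≤ u → u ≤ k ℕ.+ m →
    MinorDuality k m M P → MinorDuality k m (addRow t u c M) (addRow u t (- c) P)
  MinorDuality-addRow t u c M P adj 1≤t t≤L 1≤u u≤L dual r s rbar sbar Vr Vs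
    with FinP.any? (λ i → r i ℕ.≟ t)
  ... | no t∉r = begin
    det (submatrix (addRow t u c M) r s)    ≡⟨ det-addRow-untouched r s t u c M (λ i ri≡t → t∉r (i , ri≡t)) ⟩
    det (submatrix M r s)                   ≡⟨ dual r s rbar sbar Vr Vs ⟩
    ε * det (submatrix P rbar sbar)         ≡⟨ cong (ε *_) (det-addRow-source sbar complement-increasing u t (- c) P
                                                 (Adjacentℕ-sym adj) (proj₂ t∈rbar)) ⟨
    ε * det (submatrix (addRow u t (- c) P) rbar sbar) ∎
    where
    open ≡-Reasoning
    open Complementary Vr
    ε = complementSign rbar sbar
    t∈rbar = complement-covers t 1≤t t≤L (λ j t≡rj → t∉r (j , sym t≡rj))
  ... | yes (p , rp≡t) with FinP.any? (λ i → r i ℕ.≟ u)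
  ...   | yes (p₀ , rp₀≡u) = begin
    det (submatrix (addRow t u c M) r s)    ≡⟨ det-addRow-source s increasing t u c M adj rp₀≡u ⟩
    det (submatrix M r s)                   ≡⟨ dual r s rbar sbar Vr Vs ⟩
    ε * det (submatrix P rbar sbar)         ≡⟨ cong (ε *_) (det-addRow-untouched rbar sbar u t (- c) P
                                                 (λ i rbari≡u → complement-disjoint i p₀ (trans rbari≡u (sym rp₀≡u)))) ⟨
    ε * det (submatrix (addRow u t (- c) P) rbar sbar) ∎
    where
    open ≡-Reasoning
    open Complementary Vr
    ε = complementSign rbar sbar
  ...   | no u∉r with Complementary.complement-covers Vr u 1≤u u≤L (λ j u≡rj → u∉r (j , sym u≡rj))
  ...     | q , rbarq≡u = MinorDuality-addRow-exchange t u c M P adj dual r s rbar sbar Vr Vs rp≡t rbarq≡u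

  δ : ℕMatrix
  δ x y = if does (x ℕ.≟ y) then + 1 else + 0

  δ-≡ : ∀ x → δ x x ≡ + 1
  δ-≡ x = if-does-yes (x ℕ.≟ x) refl

  δ-≢ : ∀ x y → x ≢ y → δ x y ≡ + 0
  δ-≢ x y = if-does-no (x ℕ.≟ y)

  det-δ-identity : ∀ {a} {r s : Fin a → ℕ} → StrictlyIncreasing r → (∀ i → r i ≡ s i) →
    det (submatrix δ r s) ≡ + 1
  det-δ-identity {r = r} inc r≗s = det-identity _
    (λ i → trans (cong (δ (r i)) (sym (r≗s i))) (δ-≡ (r i)))
    (λ i j i≢j → trans (cong (δ (r i)) (sym (r≗s j)))
                   (δ-≢ (r i) (r j) (i≢j ∘ strictlyIncreasing-injective inc i j)))

  det-δ-zeroRow : ∀ {a} (r s : Fin a → ℕ) i → ¬ (r i ∈ᵣ s) → det (submatrix δ r s) ≡ + 0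
  det-δ-zeroRow r s i ri∉s = det-zeroRow (submatrix δ r s) i (λ j → δ-≢ (r i) (s j) (λ e → ri∉s (j , e)))

  det-δ-zeroColumn : ∀ {a} (r s : Fin a → ℕ) j → ¬ (s j ∈ᵣ r) → det (submatrix δ r s) ≡ + 0
  det-δ-zeroColumn r s j sj∉r = det-zeroColumn (submatrix δ r s) j (λ i → δ-≢ (r i) (s j) (λ e → sj∉r (i , sym e)))

  Complementary-≗ : ∀ {k m L} {r s : Fin k → ℕ} {rbar sbar : Fin m → ℕ} →
    Complementary L r rbar → Complementary L s sbar →
    (∀ a → r a ∈ᵣ s) → (∀ q → rbar q ∈ᵣ sbar) → (∀ a → r a ≡ s a) × (∀ q → rbar q ≡ sbar q)
  Complementary-≗ {r = r} {s} {rbar} {sbar} Vr Vs r⊆s rbar⊆sbar =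
    strictlyIncreasing-unique R.increasing S.increasing r⊆s s⊆r ,
    strictlyIncreasing-unique R.complement-increasing S.complement-increasing rbar⊆sbar sbar⊆rbar
    where
    module R = Complementary Vr
    module S = Complementary Vs
    s⊆r : ∀ b → s b ∈ᵣ r
    s⊆r b with R.∈-or-∈complement (s b) (S.≥1 b) (S.≤L b)
    ... | inj₁ sb∈r          = sb∈r
    ... | inj₂ (q , sb≡rbarq) = ⊥-elim (S.complement-disjoint (proj₁ (rbar⊆sbar q)) b
                                  (sym (trans sb≡rbarq (proj₂ (rbar⊆sbar q)))))
    sbar⊆rbar : ∀ b → sbar b ∈ᵣ rbar
    sbar⊆rbar b with R.∈-or-∈complement (sbar b) (S.complement-≥1 b) (S.complement-≤L b)
    ... | inj₂ sbarb∈rbar      = sbarb∈rbar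
    ... | inj₁ (a , sbarb≡ra) = ⊥-elim (S.complement-disjoint b (proj₁ (r⊆s a)) (trans sbarb≡ra (proj₂ (r⊆s a))))

  bothVanish : ∀ {x y ε} → x ≡ + 0 → y ≡ + 0 → x ≡ ε * y
  bothVanish {ε = ε} x≡0 y≡0 = trans x≡0 (sym (trans (cong (ε *_) y≡0) (ℤP.*-zeroʳ ε)))

  -- A minor of the identity is 1 if its rows and columns are the same and 0 otherwise.
  MinorDuality-δ : ∀ k m → MinorDuality k m δ δ
  MinorDuality-δ k m r s rbar sbar Vr Vs
    with FinP.all? (λ a → r a ∈ᵣ? s) | FinP.all? (λ q → rbar q ∈ᵣ? sbar)
  ... | no r⊈s | _ with FinP.¬∀⟶∃¬ k _ (λ a → r a ∈ᵣ? s) r⊈s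
  ...   | a , ra∉s with Complementary.∈-or-∈complement Vs (r a) (Complementary.≥1 Vr a) (Complementary.≤L Vr a)
  ...     | inj₁ ra∈s          = ⊥-elim (ra∉s ra∈s)
  ...     | inj₂ (b , ra≡sbarb) = bothVanish {ε = complementSign rbar sbar}
    (det-δ-zeroRow r s a ra∉s)
    (det-δ-zeroColumn rbar sbar b (λ (q , sbarb≡rbarq) → R.complement-disjoint q a (trans (sym sbarb≡rbarq) (sym ra≡sbarb))))
    where module R = Complementary Vr
  MinorDuality-δ k m r s rbar sbar Vr Vs | yes _ | no rbar⊈sbar
    with FinP.¬∀⟶∃¬ m _ (λ q → rbar q ∈ᵣ? sbar) rbar⊈sbar
  ... | q , rbarq∉sbar
    with Complementary.∈-or-∈complement Vs (rbar q) (Complementary.complement-≥1 Vr q) (Complementary.complement-≤L Vr q)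
  ...   | inj₂ rbarq∈sbar     = ⊥-elim (rbarq∉sbar rbarq∈sbar)
  ...   | inj₁ (b , rbarq≡sb) = bothVanish {ε = complementSign rbar sbar}
    (det-δ-zeroColumn r s b (λ (a , sb≡ra) → R.complement-disjoint q a (trans rbarq≡sb sb≡ra)))
    (det-δ-zeroRow rbar sbar q rbarq∉sbar)
    where module R = Complementary Vr
  MinorDuality-δ k m r s rbar sbar Vr Vs | yes r⊆s | yes rbar⊆sbar = begin
    det (submatrix δ r s)                  ≡⟨ det-δ-identity (Complementary.increasing Vr) r≗s ⟩
    + 1                                    ≡⟨ ℤP.*-identityˡ (+ 1) ⟨
    + 1 * + 1                              ≡⟨ cong₂ _*_ (complementSign-diagonal rbar sbar rbar≗sbar)
                                                (det-δ-identity (Complementary.complement-increasing Vr) rbar≗sbar) ⟨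
    complementSign rbar sbar * det (submatrix δ rbar sbar) ∎
    where
    open ≡-Reasoning
    r≗s = proj₁ (Complementary-≗ Vr Vs r⊆s rbar⊆sbar)
    rbar≗sbar = proj₂ (Complementary-≗ Vr Vs r⊆s rbar⊆sbar)

  -- Linear recurrences on ℤ

  recSum-cong : ∀ q {F G : ℤ → ℤ} → (∀ N → F N ≡ G N) → ∀ N → recSum q F N ≡ recSum q G N
  recSum-cong []      e N = refl
  recSum-cong (c ∷ q) e N = cong₂ _+_ (cong (c *_) (e N)) (recSum-cong q e (N - + 1))

  recSum-linear : ∀ q (F G : ℤ → ℤ) a N →
    recSum q (λ N → F N + a * G N) N ≡ recSum q F N + a * recSum q G N
  recSum-linear []      F G a N = sym (cong (_+_ (+ 0)) (ℤP.*-zeroʳ a))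
  recSum-linear (c ∷ q) F G a N =
    trans (cong (_+_ (c * (F N + a * G N))) (recSum-linear q F G a (N - + 1)))
          (distrib c (F N) (G N) a (recSum q F (N - + 1)) (recSum q G (N - + 1)))
    where
    distrib : ∀ c f g a x y → c * (f + a * g) + (x + a * y) ≡ c * f + x + a * (c * g + y)
    distrib = solve-∀

  recSum-zero : ∀ q N → recSum q (λ _ → + 0) N ≡ + 0
  recSum-zero []      N = refl
  recSum-zero (c ∷ q) N = cong₂ _+_ (ℤP.*-zeroʳ c) (recSum-zero q (N - + 1))

  recSum-shift : ∀ q (F : ℤ → ℤ) d N → recSum q (λ N → F (N + d)) N ≡ recSum q F (N + d)
  recSum-shift []      F d N = refl
  recSum-shift (c ∷ q) F d N =
    cong (_+_ (c * F (N + d))) (trans (recSum-shift q F d (N - + 1)) (cong (recSum q F) (reorder N d)))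
    where
    reorder : ∀ N d → N - + 1 + d ≡ N + d - + 1
    reorder = solve-∀

  recSum-comm : ∀ p q (F : ℤ → ℤ) N → recSum p (recSum q F) N ≡ recSum q (recSum p F) N
  recSum-comm []      q F N = sym (recSum-zero q N)
  recSum-comm (c ∷ p) q F N = sym (begin
    recSum q (λ N → c * F N + recSum p F (N - + 1)) N
      ≡⟨ recSum-cong q (λ N → sym (unit (c * F N) (recSum p F (N - + 1)))) N ⟩
    recSum q (λ N → (+ 0 + c * F N) + + 1 * recSum p F (N - + 1)) N
      ≡⟨ recSum-linear q (λ N → + 0 + c * F N) (λ N → recSum p F (N - + 1)) (+ 1) N ⟩
    recSum q (λ N → + 0 + c * F N) N + + 1 * recSum q (λ N → recSum p F (N - + 1)) N
      ≡⟨ cong₂ (λ x y → x + + 1 * y)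
           (trans (recSum-linear q (λ _ → + 0) F c N) (cong (_+ c * recSum q F N) (recSum-zero q N)))
           (recSum-shift q (recSum p F) (- + 1) N) ⟩
    + 0 + c * recSum q F N + + 1 * recSum q (recSum p F) (N - + 1)
      ≡⟨ cong (λ z → + 0 + c * recSum q F N + + 1 * z) (sym (recSum-comm p q F (N - + 1))) ⟩
    + 0 + c * recSum q F N + + 1 * recSum p (recSum q F) (N - + 1)
      ≡⟨ unit (c * recSum q F N) (recSum p (recSum q F) (N - + 1)) ⟩
    c * recSum q F N + recSum p (recSum q F) (N - + 1) ∎)
    where
    open ≡-Reasoning
    unit : ∀ x y → + 0 + x + + 1 * y ≡ x + y
    unit = solve-∀

  recSum* : List (List ℤ) → (ℤ → ℤ) → ℤ → ℤ
  recSum* []      F   = F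
  recSum* (q ∷ Q) F N = recSum q (recSum* Q F) N

  recSum*-cong : ∀ Q {F G : ℤ → ℤ} → (∀ N → F N ≡ G N) → ∀ N → recSum* Q F N ≡ recSum* Q G N
  recSum*-cong []      e N = e N
  recSum*-cong (q ∷ Q) e N = recSum-cong q (recSum*-cong Q e) N

  recSum*-linear : ∀ Q (F G : ℤ → ℤ) a N →
    recSum* Q (λ N → F N + a * G N) N ≡ recSum* Q F N + a * recSum* Q G N
  recSum*-linear []      F G a N = refl
  recSum*-linear (q ∷ Q) F G a N =
    trans (recSum-cong q (recSum*-linear Q F G a) N) (recSum-linear q (recSum* Q F) (recSum* Q G) a N)

  recSum*-zero : ∀ Q N → recSum* Q (λ _ → + 0) N ≡ + 0
  recSum*-zero []      N = refl
  recSum*-zero (q ∷ Q) N = trans (recSum-cong q (recSum*-zero Q) N) (recSum-zero q N)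

  recSum*-shift : ∀ Q (F : ℤ → ℤ) d N → recSum* Q (λ N → F (N + d)) N ≡ recSum* Q F (N + d)
  recSum*-shift []      F d N = refl
  recSum*-shift (q ∷ Q) F d N =
    trans (recSum-cong q (λ N → recSum*-shift Q F d N) N) (recSum-shift q (recSum* Q F) d N)

  recSum*-comm : ∀ Q p (F : ℤ → ℤ) N → recSum p (recSum* Q F) N ≡ recSum* Q (recSum p F) N
  recSum*-comm []      p F N = refl
  recSum*-comm (q ∷ Q) p F N =
    trans (recSum-comm p q (recSum* Q F) N) (recSum-cong q (λ N → recSum*-comm Q p F N) N)

  AnnihilatedBy : List (List ℤ) → (ℤ → ℤ) → Set
  AnnihilatedBy Q F = ∀ N → recSum* Q F N ≡ + 0

  annihilatedBy-∈ : ∀ P q Q F → (∀ N → recSum q F N ≡ + 0) → AnnihilatedBy (P ++ q ∷ Q) F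
  annihilatedBy-∈ []      q Q F ann N = trans (recSum*-comm Q q F N) (trans (recSum*-cong Q ann N) (recSum*-zero Q N))
  annihilatedBy-∈ (p ∷ P) q Q F ann N = trans (recSum-cong p (annihilatedBy-∈ P q Q F ann) N) (recSum-zero p N)

  VanishesFrom : ℕ → (ℤ → ℤ) → Set
  VanishesFrom t F = ∀ n → t ≤ n → F (+ n) ≡ + 0

  recSum-vanishesFrom : ∀ q t F → VanishesFrom t F → VanishesFrom (t ℕ.+ length q) (recSum q F)
  recSum-vanishesFrom []      t F v n t≤n = refl
  recSum-vanishesFrom (c ∷ q) t F v zero    t+1+l≤0 with subst (_≤ 0) (ℕP.+-suc t (length q)) t+1+l≤0
  ... | ()
  recSum-vanishesFrom (c ∷ q) t F v (suc n) t+1+l≤1+n = trans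
    (cong₂ _+_ (cong (c *_) (v (suc n) (ℕP.≤-trans (ℕP.m≤m+n t (suc (length q))) t+1+l≤1+n)))
               (recSum-vanishesFrom q t F v n (ℕP.≤-pred (subst (_≤ suc n) (ℕP.+-suc t (length q)) t+1+l≤1+n))))
    (cong (_+ + 0) (ℤP.*-zeroʳ c))

  recSum*-vanishesFrom : ∀ Q t F → VanishesFrom t F → ∃ λ t′ → VanishesFrom t′ (recSum* Q F)
  recSum*-vanishesFrom []      t F v = t , v
  recSum*-vanishesFrom (q ∷ Q) t F v with recSum*-vanishesFrom Q t F v
  ... | t′ , v′ = t′ ℕ.+ length q , recSum-vanishesFrom q t′ (recSum* Q F) v′

  Nonzero : List ℤ → Set
  Nonzero = Any (_≢ + 0)

  recSum-zeroCoefficients : ∀ q F N → All (_≡ + 0) q → recSum q F N ≡ + 0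
  recSum-zeroCoefficients []      F N []         = refl
  recSum-zeroCoefficients (c ∷ q) F N (refl ∷ z) =
    cong₂ _+_ (ℤP.*-zeroˡ (F N)) (recSum-zeroCoefficients q F (N - + 1) z)

  ¬Nonzero⇒zero : ∀ q → ¬ Nonzero q → All (_≡ + 0) q
  ¬Nonzero⇒zero []      _  = []
  ¬Nonzero⇒zero (c ∷ q) ¬nz with c ℤ.≟ + 0
  ... | yes c≡0 = c≡0 ∷ ¬Nonzero⇒zero q (¬nz ∘ there)
  ... | no c≢0  = ⊥-elim (¬nz (here c≢0))

  -- j is the index of the last nonzero coefficient c of q.
  recSum-isolates : ∀ q → Nonzero q → ∀ (F : ℤ → ℤ) M → (∀ j → F (M + + suc j) ≡ + 0) →
    Σ ℤ λ c → (c ≢ + 0) × Σ ℕ λ j → recSum q F (M + + j) ≡ c * F M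
  recSum-isolates (c ∷ q) nz F M above with any? (λ x → ¬? (x ℤ.≟ + 0)) q
  ... | yes nz′ with recSum-isolates q nz′ F M above
  ...   | c′ , c′≢0 , j , e = c′ , c′≢0 , suc j ,
    trans (cong₂ _+_ (trans (cong (c *_) (above j)) (ℤP.*-zeroʳ c)) (trans (cong (recSum q F) (shift M (+ j))) e))
          (ℤP.+-identityˡ (c′ * F M))
    where
    shift : ∀ M J → M + (+ 1 + J) - + 1 ≡ M + J
    shift = solve-∀
  recSum-isolates (c ∷ q) nz F M above | no ¬nz′ = c , c≢0 nz , 0 ,
    trans (cong₂ _+_ (cong (c *_) (cong F (ℤP.+-identityʳ M)))
                     (recSum-zeroCoefficients q F (M + + 0 - + 1) (¬Nonzero⇒zero q ¬nz′)))
          (ℤP.+-identityʳ (c * F M))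
    where
    c≢0 : Nonzero (c ∷ q) → c ≢ + 0
    c≢0 (here c≢0)  = c≢0
    c≢0 (there nz′) = ⊥-elim (¬nz′ nz′)

  -- Descend, one step at a time, from the point where F starts to vanish.
  annihilated-vanishesFrom⇒zero : ∀ q → Nonzero q → ∀ (F : ℤ → ℤ) → (∀ N → recSum q F N ≡ + 0) →
    ∀ t → VanishesFrom t F → ∀ N → F N ≡ + 0
  annihilated-vanishesFrom⇒zero q nz F ann t v = everywhere
    where
    fromBelow : ∀ j n → F (+ t - + j + + n) ≡ + 0
    fromBelow zero    n = trans (cong (λ x → F (x + + n)) (ℤP.+-identityʳ (+ t))) (v (t ℕ.+ n) (ℕP.m≤m+n t n))
    fromBelow (suc j) n = step n
      where
      M = + t - + suc j
      above : ∀ i → F (M + + suc i) ≡ + 0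
      above i = trans (cong F (reindex (+ t) (+ j) (+ i))) (fromBelow j i)
        where
        reindex : ∀ T J I → T - (+ 1 + J) + (+ 1 + I) ≡ T - J + I
        reindex = solve-∀
      FM≡0 : F M ≡ + 0
      FM≡0 with recSum-isolates q nz F M above
      ... | c , c≢0 , j′ , e with ℤP.i*j≡0⇒i≡0∨j≡0 c (trans (sym e) (ann (M + + j′)))
      ...   | inj₁ c≡0  = ⊥-elim (c≢0 c≡0)
      ...   | inj₂ FM≡0 = FM≡0
      step : ∀ n → F (M + + n) ≡ + 0
      step zero    = trans (cong F (ℤP.+-identityʳ M)) FM≡0
      step (suc n) = above n
    everywhere : ∀ N → F N ≡ + 0
    everywhere (+ n)    = trans (cong F (sym (reindex (+ t) (+ n)))) (fromBelow t n)
      where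
      reindex : ∀ T N → T - T + N ≡ N
      reindex = solve-∀
    everywhere -[1+ n ] = trans (cong F (sym (reindex (+ t) (+ suc n)))) (fromBelow (t ℕ.+ suc n) 0)
      where
      reindex : ∀ T S → T - (T + S) + + 0 ≡ - S
      reindex = solve-∀

  annihilatedBy-vanishesFrom⇒zero : ∀ Q → All Nonzero Q → ∀ F → AnnihilatedBy Q F →
    ∀ t → VanishesFrom t F → ∀ N → F N ≡ + 0
  annihilatedBy-vanishesFrom⇒zero []      []         F ann t v = ann
  annihilatedBy-vanishesFrom⇒zero (q ∷ Q) (nz ∷ nzs) F ann t v =
    annihilatedBy-vanishesFrom⇒zero Q nzs F
      (annihilated-vanishesFrom⇒zero q nz (recSum* Q F) ann
        (proj₁ (recSum*-vanishesFrom Q t F v)) (proj₂ (recSum*-vanishesFrom Q t F v)))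
      t v

  -- The difference of the two sides is annihilated by the composite of the three recurrences
  -- and vanishes on ℕ.
  recurrence-extends : ∀ (F U D : ℤ → ℤ) (qF qU qD : List ℤ) → Nonzero qF → Nonzero qU → Nonzero qD →
    (∀ N → recSum qF F N ≡ + 0) → (∀ N → recSum qU U N ≡ + 0) → (∀ N → recSum qD D N ≡ + 0) →
    (∀ n → F (+ n + + 1) ≡ U (+ n) + D (+ n)) → ∀ N → F (N + + 1) ≡ U N + D N
  recurrence-extends F U D qF qU qD nzF nzU nzD annF annU annD onℕ N =
    trans (split (F (N + + 1)) (U N) (D N)) (trans (cong (_+ (U N + D N)) (R≡0 N)) (ℤP.+-identityˡ (U N + D N)))
    where
    Q = qF ∷ qU ∷ qD ∷ []
    R : ℤ → ℤ
    R N = F (N + + 1) + - + 1 * (U N + + 1 * D N)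
    annR : AnnihilatedBy Q R
    annR N = begin
      recSum* Q R N
        ≡⟨ recSum*-linear Q (λ N → F (N + + 1)) (λ N → U N + + 1 * D N) (- + 1) N ⟩
      recSum* Q (λ N → F (N + + 1)) N + - + 1 * recSum* Q (λ N → U N + + 1 * D N) N
        ≡⟨ cong₂ (λ x y → x + - + 1 * y) (recSum*-shift Q F (+ 1) N) (recSum*-linear Q U D (+ 1) N) ⟩
      recSum* Q F (N + + 1) + - + 1 * (recSum* Q U N + + 1 * recSum* Q D N)
        ≡⟨ cong₂ (λ x y → x + - + 1 * y) (annihilatedBy-∈ [] qF (qU ∷ qD ∷ []) F annF (N + + 1))
             (cong₂ (λ x y → x + + 1 * y) (annihilatedBy-∈ (qF ∷ []) qU (qD ∷ []) U annU N)
                                          (annihilatedBy-∈ (qF ∷ qU ∷ []) qD [] D annD N)) ⟩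
      + 0 ∎
      where open ≡-Reasoning
    R-vanishes : VanishesFrom 0 R
    R-vanishes n _ = trans (cong (λ x → x + - + 1 * (U (+ n) + + 1 * D (+ n))) (onℕ n)) (cancel (U (+ n)) (D (+ n)))
      where
      cancel : ∀ u d → u + d + - + 1 * (u + + 1 * d) ≡ + 0
      cancel = solve-∀
    R≡0 : ∀ N → R N ≡ + 0
    R≡0 = annihilatedBy-vanishesFrom⇒zero Q (nzF ∷ nzU ∷ nzD ∷ []) R annR 0 R-vanishes
    split : ∀ x u d → x ≡ (x + - + 1 * (u + + 1 * d)) + (u + d)
    split = solve-∀

  count : ∀ {N} → (Vec Bool N → Bool) → List (Vec Bool N) → ℕ
  count v xs = length (filter (λ p → T? (v p)) xs)

  count-++ : ∀ {N} (v : Vec Bool N → Bool) xs ys → count v (xs ++ ys) ≡ count v xs ℕ.+ count v ys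
  count-++ v xs ys = trans (cong length (filter-++ (λ p → T? (v p)) xs ys)) (length-++ (filter (λ p → T? (v p)) xs))

  count-map : ∀ {N M} (v : Vec Bool N → Bool) (f : Vec Bool M → Vec Bool N) xs →
    count v (map f xs) ≡ count (v ∘ f) xs
  count-map v f []       = refl
  count-map v f (x ∷ xs) with v (f x)
  ... | true  = cong suc (count-map v f xs)
  ... | false = count-map v f xs

  count-false : ∀ {N} xs → count {N} (λ _ → false) xs ≡ 0
  count-false []       = refl
  count-false (x ∷ xs) = count-false xs

  pathsStartingUp : ℕ → ℕ → ℕ → ℕ → ℕ
  pathsStartingUp K N a b = if suc a ≤ᵇ K then C K N (suc a) b else 0

  pathsStartingDown : ℕ → ℕ → ℕ → ℕ → ℕ
  pathsStartingDown K N zero    b = 0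
  pathsStartingDown K N (suc a) b = C K N a b

  C-suc : ∀ K N a b → C K (suc N) a b ≡ pathsStartingUp K N a b ℕ.+ pathsStartingDown K N a b
  C-suc K N a b = begin
    C K (suc N) a b
      ≡⟨ count-++ (validPath K a b) (map (true ∷_) (allSteps N)) (map (false ∷_) (allSteps N)) ⟩
    count (validPath K a b) (map (true ∷_) (allSteps N)) ℕ.+ count (validPath K a b) (map (false ∷_) (allSteps N))
      ≡⟨ cong₂ ℕ._+_ (count-map (validPath K a b) (true ∷_) (allSteps N))
                     (count-map (validPath K a b) (false ∷_) (allSteps N)) ⟩
    count (validPath K a b ∘ (true ∷_)) (allSteps N) ℕ.+ count (validPath K a b ∘ (false ∷_)) (allSteps N)
      ≡⟨ cong₂ ℕ._+_ up (down a) ⟩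
    pathsStartingUp K N a b ℕ.+ pathsStartingDown K N a b ∎
    where
    open ≡-Reasoning
    up : count (validPath K a b ∘ (true ∷_)) (allSteps N) ≡ pathsStartingUp K N a b
    up with suc a ≤ᵇ K
    ... | true  = refl
    ... | false = count-false (allSteps N)
    down : ∀ a → count (validPath K a b ∘ (false ∷_)) (allSteps N) ≡ pathsStartingDown K N a b
    down zero    = count-false (allSteps N)
    down (suc a) = refl

  pathsStartingUp-≤ : ∀ K N a b → suc a ≤ K → pathsStartingUp K N a b ≡ C K N (suc a) b
  pathsStartingUp-≤ K N a b 1+a≤K with suc a ≤ᵇ K | ℕP.≤⇒≤ᵇ 1+a≤K
  ... | true | _ = refl

  pathsStartingUp-≰ : ∀ K N a b → ¬ (suc a ≤ K) → pathsStartingUp K N a b ≡ 0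
  pathsStartingUp-≰ K N a b 1+a≰K with suc a ≤ᵇ K in eq
  ... | true  = ⊥-elim (1+a≰K (ℕP.≤ᵇ⇒≤ (suc a) K (subst T (sym eq) tt)))
  ... | false = refl

  C-zero-≡ : ∀ K a → C K 0 a a ≡ 1
  C-zero-≡ K a with a ≡ᵇ a | ℕP.≡⇒≡ᵇ a a refl
  ... | true | _ = refl

  C-zero-≢ : ∀ K a b → a ≢ b → C K 0 a b ≡ 0
  C-zero-≢ K a b a≢b with a ≡ᵇ b in eq
  ... | true  = ⊥-elim (a≢b (ℕP.≡ᵇ⇒≡ a b (subst T (sym eq) tt)))
  ... | false = refl

  -- upSweep j: row a += row (a+1) for a = 1, …, j;  downSweep j: row (a+1) += row a for a = j, …, 1.
  upSweep upSweepDual downSweep downSweepDual : ℕ → ℕMatrix → ℕMatrix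
  upSweep zero        X = X
  upSweep (suc j)     X = addRow (suc j) (suc (suc j)) (+ 1) (upSweep j X)
  upSweepDual zero    X = X
  upSweepDual (suc j) X = addRow (suc (suc j)) (suc j) (- + 1) (upSweepDual j X)
  downSweep zero        X = X
  downSweep (suc j)     X = downSweep j (addRow (suc (suc j)) (suc j) (+ 1) X)
  downSweepDual zero    X = X
  downSweepDual (suc j) X = downSweepDual j (addRow (suc j) (suc (suc j)) (- + 1) X)

  MinorDuality-upSweep : ∀ {k m} j → suc j ≤ k ℕ.+ m → ∀ M P →
    MinorDuality k m M P → MinorDuality k m (upSweep j M) (upSweepDual j P)
  MinorDuality-upSweep zero    _     M P dual = dual
  MinorDuality-upSweep (suc j) 2+j≤L M P dual =
    MinorDuality-addRow (suc j) (suc (suc j)) (+ 1) (upSweep j M) (upSweepDual j P) (inj₁ refl)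
      (s≤s z≤n) (ℕP.≤-trans (ℕP.n≤1+n _) 2+j≤L) (s≤s z≤n) 2+j≤L
      (MinorDuality-upSweep j (ℕP.≤-trans (ℕP.n≤1+n _) 2+j≤L) M P dual)

  MinorDuality-downSweep : ∀ {k m} j → suc j ≤ k ℕ.+ m → ∀ M P →
    MinorDuality k m M P → MinorDuality k m (downSweep j M) (downSweepDual j P)
  MinorDuality-downSweep zero    _     M P dual = dual
  MinorDuality-downSweep (suc j) 2+j≤L M P dual =
    MinorDuality-downSweep j (ℕP.≤-trans (ℕP.n≤1+n _) 2+j≤L) _ _
      (MinorDuality-addRow (suc (suc j)) (suc j) (+ 1) M P (inj₂ refl)
        (s≤s z≤n) 2+j≤L (s≤s z≤n) (ℕP.≤-trans (ℕP.n≤1+n _) 2+j≤L) dual)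

  addRow₊₁-≡ : ∀ t u M y → addRow t u (+ 1) M t y ≡ M t y + M u y
  addRow₊₁-≡ t u M y = trans (addRow-≡ t u (+ 1) M y) (cong (_+_ (M t y)) (ℤP.*-identityˡ (M u y)))

  upSweep-above : ∀ j X a y → j < a → upSweep j X a y ≡ X a y
  upSweep-above zero    X a y _   = refl
  upSweep-above (suc j) X a y j<a =
    trans (addRow-≢ (suc j) (suc (suc j)) (+ 1) (upSweep j X) a y (λ a≡1+j → ℕP.<-irrefl (sym a≡1+j) j<a))
          (upSweep-above j X a y (ℕP.<-trans (ℕP.n<1+n j) j<a))

  upSweep-within : ∀ j X a y → 1 ≤ a → a ≤ j → upSweep j X a y ≡ X a y + X (suc a) y
  upSweep-within zero    X a y 1≤a a≤0 = ⊥-elim (ℕP.<-irrefl refl (ℕP.≤-trans 1≤a a≤0))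
  upSweep-within (suc j) X a y 1≤a a≤1+j with a ℕ.≟ suc j
  ... | yes refl = trans (addRow₊₁-≡ (suc j) (suc (suc j)) (upSweep j X) y)
      (cong₂ _+_ (upSweep-above j X (suc j) y (ℕP.n<1+n j))
                 (upSweep-above j X (suc (suc j)) y (ℕP.≤-trans (ℕP.n<1+n j) (ℕP.n≤1+n _))))
  ... | no a≢1+j = trans (addRow-≢ (suc j) (suc (suc j)) (+ 1) (upSweep j X) a y a≢1+j)
      (upSweep-within j X a y 1≤a (ℕP.≤-pred (ℕP.≤∧≢⇒< a≤1+j a≢1+j)))

  downSweep-outside : ∀ j X a y → a ≤ 1 ⊎ suc j < a → downSweep j X a y ≡ X a y
  downSweep-outside zero    X a y _ = refl
  downSweep-outside (suc j) X a y outside =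
    trans (downSweep-outside j _ a y (weaken outside))
          (addRow-≢ (suc (suc j)) (suc j) (+ 1) X a y (≢2+j outside))
    where
    weaken : a ≤ 1 ⊎ suc (suc j) < a → a ≤ 1 ⊎ suc j < a
    weaken (inj₁ a≤1)   = inj₁ a≤1
    weaken (inj₂ 2+j<a) = inj₂ (ℕP.<-trans (ℕP.n<1+n _) 2+j<a)
    ≢2+j : a ≤ 1 ⊎ suc (suc j) < a → a ≢ suc (suc j)
    ≢2+j (inj₁ (s≤s ())) refl
    ≢2+j (inj₂ 2+j<a)    refl = ℕP.<-irrefl refl 2+j<a

  downSweep-within : ∀ j X a y → 1 ≤ a → a ≤ j → downSweep j X (suc a) y ≡ X (suc a) y + X a y
  downSweep-within zero    X a y 1≤a a≤0 = ⊥-elim (ℕP.<-irrefl refl (ℕP.≤-trans 1≤a a≤0))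
  downSweep-within (suc j) X a y 1≤a a≤1+j with a ℕ.≟ suc j
  ... | yes refl = trans (downSweep-outside j _ (suc (suc j)) y (inj₂ ℕP.≤-refl))
                         (addRow₊₁-≡ (suc (suc j)) (suc j) X y)
  ... | no a≢1+j = trans (downSweep-within j _ a y 1≤a a≤j)
      (cong₂ _+_ (addRow-≢ (suc (suc j)) (suc j) (+ 1) X (suc a) y (a≢1+j ∘ ℕP.suc-injective))
                 (addRow-≢ (suc (suc j)) (suc j) (+ 1) X a y (λ a≡2+j → ℕP.<-irrefl a≡2+j (s≤s (ℕP.m≤n⇒m≤1+n a≤j)))))
    where
    a≤j : a ≤ j
    a≤j = ℕP.≤-pred (ℕP.≤∧≢⇒< a≤1+j a≢1+j)

  upSweepDual-above : ∀ j X a y → suc j < a → upSweepDual j X a y ≡ X a y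
  upSweepDual-above zero    X a y _     = refl
  upSweepDual-above (suc j) X a y 2+j<a =
    trans (addRow-≢ (suc (suc j)) (suc j) (- + 1) (upSweepDual j X) a y (λ a≡2+j → ℕP.<-irrefl (sym a≡2+j) 2+j<a))
          (upSweepDual-above j X a y (ℕP.<-trans (ℕP.n<1+n _) 2+j<a))

  upSweepDual-inverts : ∀ j (X V : ℕMatrix) y → X 1 y ≡ V 1 y →
    (∀ a → 1 ≤ a → a ≤ j → X (suc a) y ≡ V (suc a) y + V a y) →
    ∀ a → 1 ≤ a → a ≤ suc j → upSweepDual j X a y ≡ V a y
  upSweepDual-inverts zero    X V y first _ (suc zero)    _ _           = first
  upSweepDual-inverts zero    X V y _     _ (suc (suc a)) _ (s≤s ())
  upSweepDual-inverts (suc j) X V y first rest a 1≤a a≤2+j with a ℕ.≟ suc (suc j)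
  ... | yes refl = begin
    upSweepDual (suc j) X (suc (suc j)) y
      ≡⟨ addRow-≡ (suc (suc j)) (suc j) (- + 1) (upSweepDual j X) y ⟩
    upSweepDual j X (suc (suc j)) y + - + 1 * upSweepDual j X (suc j) y
      ≡⟨ cong₂ (λ x x′ → x + - + 1 * x′)
           (trans (upSweepDual-above j X (suc (suc j)) y ℕP.≤-refl) (rest (suc j) (s≤s z≤n) ℕP.≤-refl))
           (IH (suc j) (s≤s z≤n) ℕP.≤-refl) ⟩
    V (suc (suc j)) y + V (suc j) y + - + 1 * V (suc j) y
      ≡⟨ cancel (V (suc (suc j)) y) (V (suc j) y) ⟩
    V (suc (suc j)) y ∎
    where
    open ≡-Reasoning
    IH = upSweepDual-inverts j X V y first (λ a 1≤a a≤j → rest a 1≤a (ℕP.≤-trans a≤j (ℕP.n≤1+n _)))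
    cancel : ∀ v v′ → v + v′ + - + 1 * v′ ≡ v
    cancel = solve-∀
  ... | no a≢2+j = trans (addRow-≢ (suc (suc j)) (suc j) (- + 1) (upSweepDual j X) a y a≢2+j)
      (upSweepDual-inverts j X V y first (λ a 1≤a a≤j → rest a 1≤a (ℕP.≤-trans a≤j (ℕP.n≤1+n _)))
        a 1≤a (ℕP.≤-pred (ℕP.≤∧≢⇒< a≤2+j a≢2+j)))

  downSweepDual-outside : ∀ j X a y → a ≡ 0 ⊎ j < a → downSweepDual j X a y ≡ X a y
  downSweepDual-outside zero    X a y _ = refl
  downSweepDual-outside (suc j) X a y outside =
    trans (downSweepDual-outside j _ a y (weaken outside))
          (addRow-≢ (suc j) (suc (suc j)) (- + 1) X a y (≢1+j outside))
    where
    weaken : a ≡ 0 ⊎ suc j < a → a ≡ 0 ⊎ j < a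
    weaken (inj₁ a≡0)   = inj₁ a≡0
    weaken (inj₂ 1+j<a) = inj₂ (ℕP.<-trans (ℕP.n<1+n _) 1+j<a)
    ≢1+j : a ≡ 0 ⊎ suc j < a → a ≢ suc j
    ≢1+j (inj₁ refl) ()
    ≢1+j (inj₂ 1+j<a) refl = ℕP.<-irrefl refl 1+j<a

  downSweepDual-inverts : ∀ j (X W : ℕMatrix) y →
    (∀ a → 1 ≤ a → a ≤ j → X a y ≡ W a y + W (suc a) y) → X (suc j) y ≡ W (suc j) y →
    ∀ a → 1 ≤ a → a ≤ suc j → downSweepDual j X a y ≡ W a y
  downSweepDual-inverts zero    X W y _ last (suc zero)    _ _        = last
  downSweepDual-inverts zero    X W y _ _    (suc (suc a)) _ (s≤s ())
  downSweepDual-inverts (suc j) X W y rest last a 1≤a a≤2+j with a ℕ.≟ suc (suc j)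
  ... | yes refl = trans (downSweepDual-outside j X′ (suc (suc j)) y (inj₂ (ℕP.≤-trans (ℕP.n<1+n j) (ℕP.n≤1+n _))))
      (trans (addRow-≢ (suc j) (suc (suc j)) (- + 1) X (suc (suc j)) y (λ 2+j≡1+j → ℕP.<-irrefl (sym 2+j≡1+j) (ℕP.n<1+n _)))
             last)
    where X′ = addRow (suc j) (suc (suc j)) (- + 1) X
  ... | no a≢2+j = downSweepDual-inverts j X′ W y rest′ last′ a 1≤a (ℕP.≤-pred (ℕP.≤∧≢⇒< a≤2+j a≢2+j))
    where
    X′ = addRow (suc j) (suc (suc j)) (- + 1) X
    cancel : ∀ w w′ → w + w′ + - + 1 * w′ ≡ w
    cancel = solve-∀
    rest′ : ∀ a → 1 ≤ a → a ≤ j → X′ a y ≡ W a y + W (suc a) y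
    rest′ a 1≤a a≤j = trans (addRow-≢ (suc j) (suc (suc j)) (- + 1) X a y (λ a≡1+j → ℕP.<-irrefl a≡1+j (s≤s a≤j)))
      (rest a 1≤a (ℕP.≤-trans a≤j (ℕP.n≤1+n _)))
    last′ : X′ (suc j) y ≡ W (suc j) y
    last′ = trans (addRow-≡ (suc j) (suc (suc j)) (- + 1) X y)
      (trans (cong₂ (λ x x′ → x + - + 1 * x′) (rest (suc j) (s≤s z≤n) ℕP.≤-refl) last)
             (cancel (W (suc j) y) (W (suc (suc j)) y)))

  -- The path recurrence for negative lengths

  module Extension (K : ℕ) (E : ℕ → ℕ → ℤ → ℤ)
    (ext : ∀ a b → a ≤ K → b ≤ K → IsExtension K a b (E a b)) where

    E-agrees : ∀ a b → a ≤ K → b ≤ K → ∀ n → E a b (+ n) ≡ + C K n a b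
    E-agrees a b a≤K b≤K = proj₁ (ext a b a≤K b≤K)

    E↑ : ℕ → ℕ → ℤ → ℤ
    E↑ a b N with suc a ℕ.≤? K
    ... | yes _ = E (suc a) b N
    ... | no _  = + 0

    E↑-≤ : ∀ a b N → suc a ≤ K → E↑ a b N ≡ E (suc a) b N
    E↑-≤ a b N 1+a≤K with suc a ℕ.≤? K
    ... | yes _     = refl
    ... | no 1+a≰K  = ⊥-elim (1+a≰K 1+a≤K)

    E↑-≰ : ∀ a b N → ¬ (suc a ≤ K) → E↑ a b N ≡ + 0
    E↑-≰ a b N 1+a≰K with suc a ℕ.≤? K
    ... | yes 1+a≤K = ⊥-elim (1+a≰K 1+a≤K)
    ... | no _      = refl

    E↓ : ℕ → ℕ → ℤ → ℤ
    E↓ zero    b N = + 0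
    E↓ (suc a) b N = E a b N

    HasRecurrence : (ℤ → ℤ) → Set
    HasRecurrence F = Σ (List ℤ) λ q → Nonzero q × (∀ N → recSum q F N ≡ + 0)

    zero-hasRecurrence : HasRecurrence (λ _ → + 0)
    zero-hasRecurrence = + 1 ∷ [] , here (λ ()) , (λ N → refl)

    E-hasRecurrence : ∀ a b → a ≤ K → b ≤ K → HasRecurrence (E a b)
    E-hasRecurrence a b a≤K b≤K with ext a b a≤K b≤K
    ... | _ , q₀ , qs , q₀≢0 , rec = q₀ ∷ qs , here q₀≢0 , rec

    E↑-hasRecurrence : ∀ a b → b ≤ K → HasRecurrence (E↑ a b)
    E↑-hasRecurrence a b b≤K with suc a ℕ.≤? K
    ... | yes 1+a≤K = E-hasRecurrence (suc a) b 1+a≤K b≤K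
    ... | no _      = zero-hasRecurrence

    E↓-hasRecurrence : ∀ a b → a ≤ K → b ≤ K → HasRecurrence (E↓ a b)
    E↓-hasRecurrence zero    b _   _   = zero-hasRecurrence
    E↓-hasRecurrence (suc a) b a≤K b≤K = E-hasRecurrence a b (ℕP.≤-trans (ℕP.n≤1+n a) a≤K) b≤K

    E-step : ∀ a b → a ≤ K → b ≤ K → ∀ N → E a b (N + + 1) ≡ E↑ a b N + E↓ a b N
    E-step a b a≤K b≤K =
      recurrence-extends (E a b) (E↑ a b) (E↓ a b) (proj₁ RE) (proj₁ R↑) (proj₁ R↓)
        (proj₁ (proj₂ RE)) (proj₁ (proj₂ R↑)) (proj₁ (proj₂ R↓))
        (proj₂ (proj₂ RE)) (proj₂ (proj₂ R↑)) (proj₂ (proj₂ R↓)) onℕ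
      where
      RE = E-hasRecurrence a b a≤K b≤K
      R↑ = E↑-hasRecurrence a b b≤K
      R↓ = E↓-hasRecurrence a b a≤K b≤K
      up : ∀ n → + pathsStartingUp K n a b ≡ E↑ a b (+ n)
      up n with suc a ℕ.≤? K
      ... | yes 1+a≤K = trans (cong +_ (pathsStartingUp-≤ K n a b 1+a≤K)) (sym (E-agrees (suc a) b 1+a≤K b≤K n))
      ... | no 1+a≰K  = cong +_ (pathsStartingUp-≰ K n a b 1+a≰K)
      down : ∀ a → a ≤ K → ∀ n → + pathsStartingDown K n a b ≡ E↓ a b (+ n)
      down zero    _   n = refl
      down (suc a) a≤K n = sym (E-agrees a b (ℕP.≤-trans (ℕP.n≤1+n a) a≤K) b≤K n)
      onℕ : ∀ n → E a b (+ n + + 1) ≡ E↑ a b (+ n) + E↓ a b (+ n)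
      onℕ n = begin
        E a b (+ (n ℕ.+ 1))                                  ≡⟨ E-agrees a b a≤K b≤K (n ℕ.+ 1) ⟩
        + C K (n ℕ.+ 1) a b                                  ≡⟨ cong (λ N → + C K N a b) (ℕP.+-comm n 1) ⟩
        + C K (suc n) a b                                    ≡⟨ cong +_ (C-suc K n a b) ⟩
        + pathsStartingUp K n a b + + pathsStartingDown K n a b  ≡⟨ cong₂ _+_ (up n) (down a a≤K n) ⟩
        E↑ a b (+ n) + E↓ a b (+ n)                          ∎
        where open ≡-Reasoning

  height : ℕ → ℕ
  height a = 2 ℕ.* a ∸ 2

  height-suc : ∀ c → height (suc c) ≡ c ℕ.+ c
  height-suc c = cong (_∸ 1) (trans (ℕP.+-suc c (c ℕ.+ 0)) (cong (λ x → suc (c ℕ.+ x)) (ℕP.+-identityʳ c)))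

  height-injective : ∀ {a b} → 1 ≤ a → 1 ≤ b → height a ≡ height b → a ≡ b
  height-injective {a} {b} 1≤a 1≤b e =
    ℕP.*-cancelˡ-≡ a b 2 (ℕP.∸-cancelʳ-≡ (ℕP.*-monoʳ-≤ 2 1≤a) (ℕP.*-monoʳ-≤ 2 1≤b) e)

  module EvenHeights (L′ K : ℕ) (K≡ : K ≡ suc (L′ ℕ.+ L′)) (E : ℕ → ℕ → ℤ → ℤ)
    (ext : ∀ a b → a ≤ K → b ≤ K → IsExtension K a b (E a b)) where

    open Extension K E ext

    1+double≤K : ∀ {c} → c ≤ L′ → suc (c ℕ.+ c) ≤ K
    1+double≤K c≤L′ = subst (_ ≤_) (sym K≡) (s≤s (ℕP.+-mono-≤ c≤L′ c≤L′))

    double≤K : ∀ {c} → c ≤ L′ → c ℕ.+ c ≤ K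
    double≤K c≤L′ = ℕP.≤-trans (ℕP.n≤1+n _) (1+double≤K c≤L′)

    2+double≤K : ∀ {c} → suc c ≤ L′ → suc (suc (c ℕ.+ c)) ≤ K
    2+double≤K {c} 1+c≤L′ = subst (suc (suc (c ℕ.+ c)) ≤_) (sym K≡)
      (s≤s (subst (_≤ L′ ℕ.+ L′) (ℕP.+-suc c c) (ℕP.+-mono-≤ (ℕP.<⇒≤ 1+c≤L′) 1+c≤L′)))

    2+double≰K : ∀ {c} → ¬ (suc c ≤ L′) → ¬ (suc (suc (c ℕ.+ c)) ≤ K)
    2+double≰K {c} 1+c≰L′ 2+2c≤K = ℕP.<-irrefl refl
      (ℕP.<-≤-trans (s≤s (s≤s (ℕP.+-mono-≤ L′≤c L′≤c))) (subst (suc (suc (c ℕ.+ c)) ≤_) K≡ 2+2c≤K))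
      where L′≤c = ℕP.≮⇒≥ 1+c≰L′

    height≤K : ∀ a → a ≤ suc L′ → height a ≤ K
    height≤K zero    _           = z≤n
    height≤K (suc c) (s≤s c≤L′) = subst (_≤ K) (sym (height-suc c)) (double≤K c≤L′)

    evenMatrix : ℤ → ℕMatrix
    evenMatrix N a b = E (height a) (height b) N

    InRange : ℕ → Set
    InRange a = 1 ≤ a × a ≤ suc L′

    module _ (N : ℤ) (b : ℕ) (b≤ : b ≤ suc L′) where

      private
        B = height b
        B≤K = height≤K b b≤

      -- The up sweep turns the values at even heights into the values one step later at odd heights.
      upSweep-evenMatrix : ∀ c → c ≤ L′ → upSweep L′ (evenMatrix N) (suc c) b ≡ E (suc (c ℕ.+ c)) B (N + + 1)
      upSweep-evenMatrix c c≤L′ with suc c ℕ.≤? L′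
      ... | yes 1+c≤L′ = begin
        upSweep L′ (evenMatrix N) (suc c) b          ≡⟨ upSweep-within L′ (evenMatrix N) (suc c) b (s≤s z≤n) 1+c≤L′ ⟩
        E (height (suc c)) B N + E (height (suc (suc c))) B N
          ≡⟨ cong₂ (λ h h′ → E h B N + E h′ B N) (height-suc c)
               (trans (height-suc (suc c)) (cong suc (ℕP.+-suc c c))) ⟩
        E (c ℕ.+ c) B N + E (suc (suc (c ℕ.+ c))) B N ≡⟨ ℤP.+-comm (E (c ℕ.+ c) B N) _ ⟩
        E (suc (suc (c ℕ.+ c))) B N + E (c ℕ.+ c) B N ≡⟨ cong (_+ E (c ℕ.+ c) B N) (E↑-≤ _ B N (2+double≤K 1+c≤L′)) ⟨
        E↑ (suc (c ℕ.+ c)) B N + E (c ℕ.+ c) B N      ≡⟨ E-step (suc (c ℕ.+ c)) B (1+double≤K c≤L′) B≤K N ⟨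
        E (suc (c ℕ.+ c)) B (N + + 1)                 ∎
        where open ≡-Reasoning
      ... | no 1+c≰L′ = begin
        upSweep L′ (evenMatrix N) (suc c) b       ≡⟨ upSweep-above L′ (evenMatrix N) (suc c) b (ℕP.≰⇒> 1+c≰L′) ⟩
        E (height (suc c)) B N                    ≡⟨ cong (λ h → E h B N) (height-suc c) ⟩
        E (c ℕ.+ c) B N                           ≡⟨ ℤP.+-identityˡ _ ⟨
        + 0 + E (c ℕ.+ c) B N                     ≡⟨ cong (_+ E (c ℕ.+ c) B N) (E↑-≰ _ B N (2+double≰K 1+c≰L′)) ⟨
        E↑ (suc (c ℕ.+ c)) B N + E (c ℕ.+ c) B N  ≡⟨ E-step (suc (c ℕ.+ c)) B (1+double≤K c≤L′) B≤K N ⟨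
        E (suc (c ℕ.+ c)) B (N + + 1)             ∎
        where open ≡-Reasoning

      -- …and the down sweep turns those into the values at even heights after the second step.
      evenMatrix-twoSteps : ∀ a → InRange a →
        evenMatrix ((N + + 1) + + 1) a b ≡ downSweep L′ (upSweep L′ (evenMatrix N)) a b
      evenMatrix-twoSteps (suc zero) _ = begin
        E 0 B ((N + + 1) + + 1)                            ≡⟨ E-step 0 B z≤n B≤K (N + + 1) ⟩
        E↑ 0 B (N + + 1) + + 0                             ≡⟨ ℤP.+-identityʳ _ ⟩
        E↑ 0 B (N + + 1)                                   ≡⟨ E↑-≤ 0 B (N + + 1) (1+double≤K z≤n) ⟩
        E 1 B (N + + 1)                                    ≡⟨ upSweep-evenMatrix 0 z≤n ⟨
        upSweep L′ (evenMatrix N) 1 b                      ≡⟨ downSweep-outside L′ _ 1 b (inj₁ ℕP.≤-refl) ⟨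
        downSweep L′ (upSweep L′ (evenMatrix N)) 1 b       ∎
        where open ≡-Reasoning
      evenMatrix-twoSteps (suc (suc c)) (_ , s≤s 1+c≤L′) = begin
        E (height (suc (suc c))) B ((N + + 1) + + 1)
          ≡⟨ cong (λ h → E h B ((N + + 1) + + 1)) (trans (height-suc (suc c)) (ℕP.+-suc (suc c) c)) ⟩
        E (suc (suc (c ℕ.+ c))) B ((N + + 1) + + 1)
          ≡⟨ E-step (suc (suc (c ℕ.+ c))) B (2+double≤K 1+c≤L′) B≤K (N + + 1) ⟩
        E↑ (suc (suc (c ℕ.+ c))) B (N + + 1) + E (suc (c ℕ.+ c)) B (N + + 1)
          ≡⟨ cong (_+ E (suc (c ℕ.+ c)) B (N + + 1))
               (trans (E↑-≤ _ B (N + + 1) (subst (_≤ K) (cong suc (ℕP.+-suc (suc c) c)) (1+double≤K 1+c≤L′)))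
                      (cong (λ h → E h B (N + + 1)) (cong suc (sym (ℕP.+-suc (suc c) c))))) ⟩
        E (suc (suc c ℕ.+ suc c)) B (N + + 1) + E (suc (c ℕ.+ c)) B (N + + 1)
          ≡⟨ cong₂ _+_ (upSweep-evenMatrix (suc c) 1+c≤L′) (upSweep-evenMatrix c (ℕP.<⇒≤ 1+c≤L′)) ⟨
        upSweep L′ (evenMatrix N) (suc (suc c)) b + upSweep L′ (evenMatrix N) (suc c) b
          ≡⟨ downSweep-within L′ _ (suc c) b (s≤s z≤n) 1+c≤L′ ⟨
        downSweep L′ (upSweep L′ (evenMatrix N)) (suc (suc c)) b ∎
        where open ≡-Reasoning

    δ-evenMatrix : ∀ a b → InRange a → InRange b → δ a b ≡ evenMatrix (+ 0) a b
    δ-evenMatrix a b (1≤a , a≤) (1≤b , b≤) with a ℕ.≟ b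
    ... | yes refl = trans (δ-≡ a)
      (sym (trans (E-agrees (height a) (height a) (height≤K a a≤) (height≤K a a≤) 0) (cong +_ (C-zero-≡ K (height a)))))
    ... | no a≢b = trans (δ-≢ a b a≢b)
      (sym (trans (E-agrees (height a) (height b) (height≤K a a≤) (height≤K b b≤) 0)
        (cong +_ (C-zero-≢ K (height a) (height b) (a≢b ∘ height-injective 1≤a 1≤b)))))

    -- Both sweeps only read rows in range, so only those rows of the argument matter.
    downSweep∘upSweep-cong : ∀ (X X′ : ℕMatrix) b → (∀ a → InRange a → X a b ≡ X′ a b) →
      ∀ a → InRange a → downSweep L′ (upSweep L′ X) a b ≡ downSweep L′ (upSweep L′ X′) a b
    downSweep∘upSweep-cong X X′ b X≗X′ = down
      where
      up : ∀ a → InRange a → upSweep L′ X a b ≡ upSweep L′ X′ a b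
      up a (1≤a , a≤) with a ℕ.≤? L′
      ... | yes a≤L′ = trans (upSweep-within L′ X a b 1≤a a≤L′)
          (trans (cong₂ _+_ (X≗X′ a (1≤a , a≤)) (X≗X′ (suc a) (s≤s z≤n , s≤s a≤L′)))
                 (sym (upSweep-within L′ X′ a b 1≤a a≤L′)))
      ... | no a≰L′ = trans (upSweep-above L′ X a b (ℕP.≰⇒> a≰L′))
          (trans (X≗X′ a (1≤a , a≤)) (sym (upSweep-above L′ X′ a b (ℕP.≰⇒> a≰L′))))
      down : ∀ a → InRange a → downSweep L′ (upSweep L′ X) a b ≡ downSweep L′ (upSweep L′ X′) a b
      down (suc zero) range = trans (downSweep-outside L′ _ 1 b (inj₁ ℕP.≤-refl))
        (trans (up 1 range) (sym (downSweep-outside L′ _ 1 b (inj₁ ℕP.≤-refl))))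
      down (suc (suc c)) (1≤a , s≤s 1+c≤L′) = trans (downSweep-within L′ _ (suc c) b (s≤s z≤n) 1+c≤L′)
        (trans (cong₂ _+_ (up (suc (suc c)) (1≤a , s≤s 1+c≤L′)) (up (suc c) (s≤s z≤n , ℕP.m≤n⇒m≤1+n 1+c≤L′)))
               (sym (downSweep-within L′ _ (suc c) b (s≤s z≤n) 1+c≤L′)))

    forward backward : ℕ → ℕMatrix
    forward zero     = δ
    forward (suc n)  = downSweep L′ (upSweep L′ (forward n))
    backward zero    = δ
    backward (suc n) = downSweepDual L′ (upSweepDual L′ (backward n))

    forward≡evenMatrix : ∀ n a b → InRange a → InRange b → forward n a b ≡ evenMatrix (+ (2 ℕ.* n)) a b
    forward≡evenMatrix zero    a b ra rb = δ-evenMatrix a b ra rb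
    forward≡evenMatrix (suc n) a b ra rb = begin
      downSweep L′ (upSweep L′ (forward n)) a b
        ≡⟨ downSweep∘upSweep-cong (forward n) (evenMatrix (+ (2 ℕ.* n))) b
             (λ a′ ra′ → forward≡evenMatrix n a′ b ra′ rb) a ra ⟩
      downSweep L′ (upSweep L′ (evenMatrix (+ (2 ℕ.* n)))) a b
        ≡⟨ evenMatrix-twoSteps (+ (2 ℕ.* n)) b (proj₂ rb) a ra ⟨
      evenMatrix (+ (2 ℕ.* n ℕ.+ 1 ℕ.+ 1)) a b
        ≡⟨ cong (λ e → evenMatrix (+ e) a b) (ℕP.+-assoc (2 ℕ.* n) 1 1) ⟩
      evenMatrix (+ (2 ℕ.* n ℕ.+ 2)) a b
        ≡⟨ cong (λ e → evenMatrix (+ e) a b) (trans (ℕP.+-comm (2 ℕ.* n) 2) (sym (ℕP.*-suc 2 n))) ⟩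
      evenMatrix (+ (2 ℕ.* suc n)) a b ∎
      where open ≡-Reasoning

    -- The dual sweeps undo the sweeps, so the backward sequence runs the walk backwards in time.
    backward≡evenMatrix : ∀ n a b → InRange a → InRange b → backward n a b ≡ evenMatrix (- + (2 ℕ.* n)) a b
    backward≡evenMatrix zero    a b ra rb = δ-evenMatrix a b ra rb
    backward≡evenMatrix (suc n) a b (1≤a , a≤) rb =
      downSweepDual-inverts L′ (upSweepDual L′ (backward n)) Z b
        (λ a′ 1≤a′ a′≤L′ → trans (undoDown a′ (1≤a′ , ℕP.m≤n⇒m≤1+n a′≤L′)) (upSweep-within L′ Z a′ b 1≤a′ a′≤L′))
        (trans (undoDown (suc L′) (s≤s z≤n , ℕP.≤-refl)) (upSweep-above L′ Z (suc L′) b (ℕP.n<1+n L′)))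
        a 1≤a a≤
      where
      Z = evenMatrix (- + (2 ℕ.* suc n))
      later : - + (2 ℕ.* suc n) + + 1 + + 1 ≡ - + (2 ℕ.* n)
      later = trans (cong (λ e → - + e + + 1 + + 1) (ℕP.*-suc 2 n)) (shift (+ (2 ℕ.* n)))
        where
        shift : ∀ X → - (+ 2 + X) + + 1 + + 1 ≡ - X
        shift = solve-∀
      backward-n : ∀ a → InRange a → backward n a b ≡ downSweep L′ (upSweep L′ Z) a b
      backward-n a ra = trans (backward≡evenMatrix n a b ra rb)
        (trans (cong (λ N → evenMatrix N a b) (sym later)) (evenMatrix-twoSteps (- + (2 ℕ.* suc n)) b (proj₂ rb) a ra))
      undoDown : ∀ a → InRange a → upSweepDual L′ (backward n) a b ≡ upSweep L′ Z a b
      undoDown a (1≤a , a≤) = upSweepDual-inverts L′ (backward n) (upSweep L′ Z) b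
        (trans (backward-n 1 (s≤s z≤n , s≤s z≤n)) (downSweep-outside L′ _ 1 b (inj₁ ℕP.≤-refl)))
        (λ a′ 1≤a′ a′≤L′ → trans (backward-n (suc a′) (s≤s z≤n , s≤s a′≤L′)) (downSweep-within L′ _ a′ b 1≤a′ a′≤L′))
        a 1≤a a≤

    MinorDuality-forward-backward : ∀ k m → k ℕ.+ m ≡ suc L′ → ∀ n → MinorDuality k m (forward n) (backward n)
    MinorDuality-forward-backward k m k+m≡ zero    = MinorDuality-δ k m
    MinorDuality-forward-backward k m k+m≡ (suc n) =
      MinorDuality-downSweep L′ L′<k+m _ _ (MinorDuality-upSweep L′ L′<k+m _ _ (MinorDuality-forward-backward k m k+m≡ n))
      where L′<k+m = ℕP.≤-reflexive (sym k+m≡)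

open import Defs
open Proof
open import Data.Nat using (ℕ; suc; _+_; _*_; _∸_; _≤_)
open import Data.Integer as ℤ using (ℤ; +_; -_; _^_)
open import Data.Fin using (Fin)
open import Data.Product using (_,_)
open import Relation.Binary.PropositionalEquality using (_≡_; refl; sym; trans; cong; module ≡-Reasoning)
open import Data.Nat.Tactic.RingSolver using (solve-∀)


theorem21 : (n k m : ℕ) → 1 ≤ k → 1 ≤ m →
    (r s : Fin k → ℕ) →
    StrictlyIncreasing r → StrictlyIncreasing s →
    ((i : Fin k) → 1 ≤ r i) → ((i : Fin k) → r i ≤ k + m) →
    ((i : Fin k) → 1 ≤ s i) → ((i : Fin k) → s i ≤ k + m) →
    (rbar sbar : Fin m → ℕ) →
    IsComplementEnum (k + m) r rbar → IsComplementEnum (k + m) s sbar →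
    (E : ℕ → ℕ → ℤ → ℤ) →
    ((a b : ℕ) → a ≤ 2 * k + 2 * m ∸ 1 → b ≤ 2 * k + 2 * m ∸ 1 →
      IsExtension (2 * k + 2 * m ∸ 1) a b (E a b)) →
    det (λ i j → + C (2 * k + 2 * m ∸ 1) (2 * n) (2 * r i ∸ 2) (2 * s j ∸ 2))
      ≡ (- + 1) ^ ℤ.∣ sumFin (λ i → + (rbar i + sbar i)) ∣
        ℤ.* det (λ i j → E (2 * rbar i ∸ 2) (2 * sbar j ∸ 2) (- + (2 * n)))
theorem21 n (suc k′) m _ _ r s r-inc s-inc r≥1 r≤ s≥1 s≤ rbar sbar r-compl s-compl E ext = begin
  det (λ i j → + C K (2 * n) (height (r i)) (height (s j)))
    ≡⟨ det-cong (λ i j → sym (trans (forward≡evenMatrix n (r i) (s j) (r≥1 i , r≤ i) (s≥1 j , s≤ j))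
                                    (E-agrees _ _ (height≤K (r i) (r≤ i)) (height≤K (s j) (s≤ j)) (2 * n)))) ⟩
  det (submatrix (forward n) r s)
    ≡⟨ MinorDuality-forward-backward (suc k′) m refl n r s rbar sbar Vr Vs ⟩
  complementSign rbar sbar ℤ.* det (submatrix (backward n) rbar sbar)
    ≡⟨ cong (complementSign rbar sbar ℤ.*_) (det-cong (λ i j →
         backward≡evenMatrix n (rbar i) (sbar j) (R.complement-≥1 i , R.complement-≤L i)
                                                 (S.complement-≥1 j , S.complement-≤L j))) ⟩
  complementSign rbar sbar ℤ.* det (λ i j → E (height (rbar i)) (height (sbar j)) (- + (2 * n))) ∎
  where
  open ≡-Reasoning
  K = 2 * suc k′ + 2 * m ∸ 1
  K≡ : K ≡ suc ((k′ + m) + (k′ + m))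
  K≡ = reduced k′ m
    where
    reduced : ∀ k′ m → k′ + suc (k′ + 0) + 2 * m ≡ suc ((k′ + m) + (k′ + m))
    reduced = solve-∀
  open EvenHeights (k′ + m) K K≡ E ext
  open Extension K E ext using (E-agrees)
  Vr : Complementary (suc k′ + m) r rbar
  Vr = record { increasing = r-inc ; ≥1 = r≥1 ; ≤L = r≤ ; complement = r-compl }
  Vs : Complementary (suc k′ + m) s sbar
  Vs = record { increasing = s-inc ; ≥1 = s≥1 ; ≤L = s≤ ; complement = s-compl }
  module R = Complementary Vr
  module S = Complementary Vs
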